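{- Let $x \equiv 4$ or $8 \pmod{12}$. There exists an ordered set $(T_0,T_1,\dots,T_{x-2})$ of $x-1$ modified row-sum matrices $\mathrm{MRSM}_{\mathbb{Z}_6}(S,3,x;\Sigma)$ (for some $S\subseteq\mathbb{Z}_6$ and row-sum lists $\Sigma$ depending on the matrix), where the columns of $T_j$ are indexed in order by the edges $(c^{(j)}_1,c^{(j)}_2),\dots,(c^{(j)}_x,c^{(j)}_1)$ of the cycle $D_j$, such that: (1) for each of $T_0,T_1,\dots,T_{x-3}$, every row sum $d \in \Sigma$ satisfies $d \equiv 3 \pmod 6$; (2) in $T_{x-2}$, exactly two row sums are $\equiv 3 \pmod 6$, and one row sum is $\equiv 0, 2,$ or $4 \pmod 6$; (3) for every edge $\{u,v\}$ of $K_x$ on $\mathbb{Z}_{x-1}\cup\{\infty\}$, exactly two columns among all the matrices are indexed by $(u,v)$ or $(v,u)$, and the cross differences from $u$ to $v$ that they represent together form $\mathbb{Z}_6$.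
   Context: A modified row-sum matrix $\mathrm{MRSM}_{\mathbb{Z}_6}(S,3,x;\Sigma)$ is a $3 \times x$ matrix over $\mathbb{Z}_6$ whose $i$-th column is an ordering of a 3-element subset $S_i \subseteq S$, and whose list of left-to-right row sums (in $\mathbb{Z}_6$) is $\Sigma$. On the point set $\mathbb{Z}_{x-1} \cup \{\infty\}$, let $C_0 = (\infty, 0, x-2, 1, x-3, 2, x-4, \dots, \tfrac{x}{2}, \tfrac{x-2}{2})$, i.e. its $k$-th entry is $\infty$ for $k=1$, $k - \frac{k+2}{2}$ for even $k$ and $x - \frac{k+1}{2}$ for odd $k\geq 3$; for $m\in\mathbb{Z}$ let $C_m$ be $C_0$ with $m$ added modulo $x-1$ to every finite entry. These $x-1$ Hamilton cycles $C_0,\dots,C_{x-2}$ decompose $2K_x$. For $j=0,\dots,x-2$ let $D_j = C_{j(x-2)/2} = (c^{(j)}_1,\dots,c^{(j)}_x)$ (subscript mod $x-1$). An entry $d$ in a column indexed by the ordered pair $(u,v)$ represents the cross difference $d$ from $u$ to $v$, equivalently the cross difference $-d$ from $v$ to $u$. -}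

module Defs where

open import Data.Nat using (ℕ; zero; suc; _+_; _*_; _∸_; _<_)
open import Data.Nat.DivMod using (_%_; _/_)
open import Data.Fin using (Fin; toℕ; zero; suc)
open import Data.Fin.Subset using (Subset; _∈_)
open import Data.Maybe using (Maybe; just; nothing)
import Data.Maybe as Maybe
open import Data.Maybe.Properties using (≡-dec)
open import Data.Nat.Properties using () renaming (_≟_ to _≟ℕ_)
open import Data.Nat.ListAction using (sum)
open import Data.List using (List; []; _∷_; map; concatMap; length; filter; _++_; allFin)
open import Data.Product using (_×_; _,_; Σ; ∃)
open import Data.Unit using (⊤)
open import Relation.Binary.PropositionalEquality using (_≡_)
open import Relation.Nullary using (yes; no; ¬_)
open import Relation.Nullary.Decidable using (⌊_⌋)

Z6 : Set
Z6 = Fin 6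

neg6 : Z6 → Z6
neg6 zero = zero
neg6 (suc zero) = suc (suc (suc (suc (suc zero))))
neg6 (suc (suc zero)) = suc (suc (suc (suc zero)))
neg6 (suc (suc (suc zero))) = suc (suc (suc zero))
neg6 (suc (suc (suc (suc zero)))) = suc (suc zero)
neg6 (suc (suc (suc (suc (suc zero))))) = suc zero

-- a mod n (total; returns a when n = 0, never used in that case)
modN : ℕ → ℕ → ℕ
modN a zero = a
modN a (suc m) = a % suc m

-- Points of Z_{x-1} ∪ {∞}: nothing = ∞, just a = a ∈ Z_{x-1} (0 ≤ a < x-1).
Pt : Set
Pt = Maybe ℕ

ValidPt : ℕ → Pt → Set
ValidPt x nothing = ⊤
ValidPt x (just a) = a < x ∸ 1

-- k-th entry (k = 1..x) of C₀.
c0 : ℕ → ℕ → Pt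
c0 x zero = nothing
c0 x (suc zero) = nothing
c0 x k with k % 2
... | zero  = just (k ∸ ((k + 2) / 2))
... | suc _ = just (x ∸ ((k + 1) / 2))

C : ℕ → ℕ → ℕ → Pt
C x m k = Maybe.map (λ a → modN (a + m) (x ∸ 1)) (c0 x k)

D : ℕ → ℕ → ℕ → Pt
D x j k = C x ((j * (x ∸ 2)) / 2) k

-- The i-th column (i : Fin x, 0-based) of T_j is indexed by the edge
-- (c^{(j)}_{i+1}, c^{(j)}_{i+2}), where c^{(j)}_{x+1} = c^{(j)}_1.
colHead : (x : ℕ) → Fin (x ∸ 1) → Fin x → Pt
colHead x j i = D x (toℕ j) (suc (toℕ i))

colTail : (x : ℕ) → Fin (x ∸ 1) → Fin x → Pt
colTail x j i = D x (toℕ j) (suc (modN (suc (toℕ i)) x))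

-- A family of x-1 matrices: T j r i = entry in row r, column i of T_j.
Matrices : ℕ → Set
Matrices x = Fin (x ∸ 1) → Fin 3 → Fin x → Z6

rowSum : (x : ℕ) → Matrices x → Fin (x ∸ 1) → Fin 3 → ℕ
rowSum x T j r = sum (map (λ i → toℕ (T j r i)) (allFin x)) % 6

-- T_j is an MRSM_{Z6}(S,3,x;Σ) for some S ⊆ Z6: every column consists of
-- three distinct elements of S (Σ is just the list of its row sums).
IsMRSM : (x : ℕ) → Matrices x → Fin (x ∸ 1) → Set
IsMRSM x T j =
  Σ (Subset 6) λ S →
    (∀ (i : Fin x) (r : Fin 3) → T j r i ∈ S) ×
    (∀ (i : Fin x) (r s : Fin 3) → T j r i ≡ T j s i → r ≡ s)

allCols : (x : ℕ) → List (Fin (x ∸ 1) × Fin x)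
allCols x = concatMap (λ j → map (λ i → (j , i)) (allFin x)) (allFin (x ∸ 1))

incident : (x : ℕ) → Pt → Pt → Fin (x ∸ 1) × Fin x → List ℕ
incident x u v (j , i) with ≡-dec _≟ℕ_ (colHead x j i) u | ≡-dec _≟ℕ_ (colTail x j i) v
                         | ≡-dec _≟ℕ_ (colHead x j i) v | ≡-dec _≟ℕ_ (colTail x j i) u
... | yes _ | yes _ | _ | _ = 0 ∷ []
... | _ | _ | yes _ | yes _ = 0 ∷ []
... | _ | _ | _ | _ = []

incidentCols : (x : ℕ) → Pt → Pt → List (Fin (x ∸ 1) × Fin x)
incidentCols x u v = concatMap (λ c → map (λ _ → c) (incident x u v c)) (allCols x)

crossDiffs : (x : ℕ) → Matrices x → Pt → Pt → Fin (x ∸ 1) × Fin x → List Z6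
crossDiffs x T u v (j , i) with ≡-dec _≟ℕ_ (colHead x j i) u | ≡-dec _≟ℕ_ (colTail x j i) v
                              | ≡-dec _≟ℕ_ (colHead x j i) v | ≡-dec _≟ℕ_ (colTail x j i) u
... | yes _ | yes _ | _ | _ = map (λ r → T j r i) (allFin 3)
... | _ | _ | yes _ | yes _ = map (λ r → neg6 (T j r i)) (allFin 3)
... | _ | _ | _ | _ = []

module Submission where

-- Write x = 4 + 4m, n = x - 1 = 2h + 1 with h = 1 + 2m. Then D_J = C_{Jh}, so every finite
-- vertex of D_J is an offset of C₀ shifted by Jh modulo n, and the edge at position i of D_J
-- depends only on the parity of i: position 2 + 2q joins the offsets 2h - q and 1 + q,
-- position 1 + 2q joins q and 2h - q, and positions 0 and n are the two edges at ∞. Solving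
-- these congruences, a finite edge {u, v}, oriented so that v - u ≡ 2 + 2q (mod n) is even,
-- occurs exactly at position 2 + 2q of D_{-(u+v)} and at position n - (2 + 2q) of
-- D_{-(u+v)-1}, both times from u to v; the edge {∞, w} occurs exactly at position 0 of
-- D_{-2w} and at position n of D_{-2w-1}.
--
-- The middle columns follow a pattern of period 4 with a permutation of {0, 2, 4} at even
-- positions and of {1, 3, 5} at odd positions, so the two columns of a finite edge together
-- form ℤ₆. Only T₀ and T_{x-2} patch a middle column, and their two patches (2, 1, 0) and
-- (5, 4, 3) fall on the same edge. The columns at ∞ depend on the parity of the matrix index
-- and complement each other across consecutive matrices. Every block of four pattern columns
-- has row sums (12, 6, 12), and the columns at ∞ together with the patches bring each row sum
-- to 3 modulo 6, except for the last row of T_{x-2}, whose sum is 0.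


open import Defs
open import Data.Nat using (ℕ; _∸_; _<_)
open import Data.Nat.DivMod using (_%_)
open import Data.Fin using (Fin; toℕ)
open import Data.List using (List; length; concatMap; allFin)
open import Data.List.Relation.Binary.Permutation.Propositional using (_↭_)
open import Data.Product using (_×_; Σ)
open import Data.Sum using (_⊎_)
open import Relation.Binary.PropositionalEquality using (_≡_; _≢_)

open import Data.Nat.ListAction using (sum)
open import Data.Nat as ℕ using (zero; suc; NonZero; parity; _+_; _*_; _≤_; z≤n; s≤s; _≟_)
import Data.Nat.Properties as ℕ
import Data.Nat.Divisibility as ℕ
open import Data.Nat.DivMod using (_/_; m≡m%n+[m/n]*n; m*n/n≡m; m*n%n≡0; [m+kn]%n≡m%n; m<n⇒m%n≡m; n%n≡0)
import Data.Nat.Tactic.RingSolver as ℕ-Ring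
open import Data.Integer as ℤ using (ℤ; +_; 0ℤ; _%ℕ_; _/ℕ_; _⊖_)
import Data.Integer.Properties as ℤ
open import Data.Integer.DivMod using (a≡a%ℕn+[a/ℕn]*n; n%ℕd<d)
open import Data.Integer.Divisibility.Signed
  using (_∣_; divides; ∣m∣n⇒∣m+n; ∣m∣n⇒∣m-n; ∣n⇒∣m*n; ∣-refl; ∣m⇒∣-m; ∣⇒∣ᵤ)
import Data.Integer.Tactic.RingSolver as ℤ-Ring
open import Data.Fin as Fin using (fromℕ<; zero; suc; #_)
import Data.Fin.Properties as Fin
open import Data.Maybe using (Maybe; just; nothing)
import Data.Fin.Subset as Subset
import Data.Fin.Subset.Properties as Subset
import Data.Maybe as Maybe
open import Data.Maybe.Properties using (≡-dec; just-injective)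
open import Data.List as List using ([]; _∷_; _++_; map; cartesianProduct)
import Data.List.Properties as List
open import Data.List.Membership.Propositional using (_∈_)
open import Data.List.Membership.Propositional.Properties using (∈-cartesianProduct⁺; ∈-allFin)
open import Data.List.Relation.Unary.Any using (here; there)
open import Data.List.Relation.Unary.All as All using (All; []; _∷_)
open import Data.List.Relation.Unary.AllPairs using ([]; _∷_)
open import Data.List.Relation.Unary.Unique.Propositional using (Unique)
open import Data.List.Relation.Unary.Unique.Propositional.Properties using (cartesianProduct⁺; allFin⁺)
open import Data.List.Relation.Binary.Permutation.Propositional
  using (↭-reflexive; ↭-sym; ↭-trans)
open import Data.List.Relation.Binary.Permutation.Propositional.Properties
  using (++⁺; ++-comm; map⁺; ↭-length)
open import Data.List.Sort.InsertionSort.Base (Fin.≤-decTotalOrder 6) using (sort)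
open import Data.List.Sort.InsertionSort.Properties (Fin.≤-decTotalOrder 6) using (sort-↭)
open import Data.Product using (_,_; proj₁; proj₂; uncurry)
open import Data.Sum using (inj₁; inj₂; [_,_]′)
open import Function using (_∘_)
open import Relation.Binary.PropositionalEquality
  using (refl; sym; trans; cong; cong₂; subst; subst₂; module ≡-Reasoning)
open import Relation.Nullary using (¬_; Dec; yes; no; contradiction)
open import Data.Parity.Base as ℙ using (0ℙ; 1ℙ)
import Data.Parity.Properties as Parity
open import Relation.Binary.Definitions using (tri<; tri≈; tri>)


∣-linear : ∀ {k a b z} (c d e : ℤ) → z ≡ c ℤ.* a ℤ.+ d ℤ.* b ℤ.+ e ℤ.* k → k ∣ a → k ∣ b → k ∣ z
∣-linear c d e refl k∣a k∣b = ∣m∣n⇒∣m+n (∣m∣n⇒∣m+n (∣n⇒∣m*n c k∣a) (∣n⇒∣m*n d k∣b)) (∣n⇒∣m*n e ∣-refl)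

∣-<⇒≡0 : ∀ {n d} → n ℕ.∣ d → d < n → d ≡ 0
∣-<⇒≡0 {d = zero}  _   _   = refl
∣-<⇒≡0 {d = suc _} n∣d d<n = contradiction (ℕ.∣⇒≤ n∣d) (ℕ.<⇒≱ d<n)

∣-≤⇒≡ : ∀ {n a b} → b ≤ a → a < n → + n ∣ + a ℤ.- + b → a ≡ b
∣-≤⇒≡ {n} {a} {b} b≤a a<n n∣a-b = ℕ.≤-antisym (ℕ.m∸n≡0⇒m≤n a∸b≡0) b≤a
  where
  a∸b≡0 : a ∸ b ≡ 0
  a∸b≡0 = ∣-<⇒≡0 (∣⇒∣ᵤ (subst (+ n ∣_) (trans (ℤ.m-n≡m⊖n a b) (ℤ.⊖-≥ b≤a)) n∣a-b))
                  (ℕ.≤-<-trans (ℕ.m∸n≤m a b) a<n)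

∣-<⇒≡ : ∀ {n a b} → a < n → b < n → + n ∣ + a ℤ.- + b → a ≡ b
∣-<⇒≡ {n} {a} {b} a<n b<n n∣a-b with ℕ.≤-total b a
... | inj₁ b≤a = ∣-≤⇒≡ b≤a a<n n∣a-b
... | inj₂ a≤b = sym (∣-≤⇒≡ a≤b b<n (subst (+ n ∣_) (negate-difference (+ a) (+ b)) (∣m⇒∣-m n∣a-b)))
  where
  negate-difference : ∀ a b → ℤ.- (a ℤ.- b) ≡ b ℤ.- a
  negate-difference = ℤ-Ring.solve-∀

module _ (n : ℕ) .{{_ : NonZero n}} where

  %ℕ-∣ : ∀ a → + n ∣ a ℤ.- + (a %ℕ n)
  %ℕ-∣ a = divides (a /ℕ n) (begin
    a ℤ.- + r                    ≡⟨ cong (ℤ._- + r) (a≡a%ℕn+[a/ℕn]*n a n) ⟩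
    + r ℤ.+ q ℤ.* + n ℤ.- + r    ≡⟨ cancel (+ r) (q ℤ.* + n) ⟩
    q ℤ.* + n                    ∎)
    where
    open ≡-Reasoning
    r = a %ℕ n
    q = a /ℕ n
    cancel : ∀ r s → r ℤ.+ s ℤ.- r ≡ s
    cancel = ℤ-Ring.solve-∀

  %ℕ-unique : ∀ a {b} → b < n → + n ∣ a ℤ.- + b → a %ℕ n ≡ b
  %ℕ-unique a {b} b<n n∣a-b = ∣-<⇒≡ (n%ℕd<d a n) b<n
    (∣-linear (ℤ.- + 1) (+ 1) 0ℤ (combine a (+ (a %ℕ n)) (+ b) (+ n)) (%ℕ-∣ a) n∣a-b)
    where
    combine : ∀ a r b n → r ℤ.- b ≡ ℤ.- + 1 ℤ.* (a ℤ.- r) ℤ.+ + 1 ℤ.* (a ℤ.- b) ℤ.+ 0ℤ ℤ.* n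
    combine = ℤ-Ring.solve-∀

%ℕ-pred : ∀ k a → (a %ℕ suc k ≡ 0 × (a ℤ.- + 1) %ℕ suc k ≡ k) ⊎ a %ℕ suc k ≡ suc ((a ℤ.- + 1) %ℕ suc k)
%ℕ-pred k a with a %ℕ suc k | %ℕ-∣ (suc k) a | n%ℕd<d a (suc k)
... | zero  | n∣a | _   = inj₁ (refl , %ℕ-unique (suc k) (a ℤ.- + 1) (ℕ.n<1+n k) (subst (+ suc k ∣_) (one-less k) (∣m∣n⇒∣m-n n∣a ∣-refl)))
  where
  one-less : ∀ k → a ℤ.- + 0 ℤ.- + suc k ≡ a ℤ.- + 1 ℤ.- + k
  one-less k = trans (cong (λ t → a ℤ.- + 0 ℤ.- t) (ℤ.pos-+ 1 k)) (identity a (+ k))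
    where
    identity : ∀ a k → a ℤ.- + 0 ℤ.- (+ 1 ℤ.+ k) ≡ a ℤ.- + 1 ℤ.- k
    identity = ℤ-Ring.solve-∀
... | suc r | n∣a | r<k = inj₂ (cong suc (sym (%ℕ-unique (suc k) (a ℤ.- + 1) (ℕ.<-trans (ℕ.n<1+n r) r<k) (subst (+ suc k ∣_) (one-less r) n∣a))))
  where
  one-less : ∀ r → a ℤ.- + suc r ≡ a ℤ.- + 1 ℤ.- + r
  one-less r = trans (cong (λ t → a ℤ.- t) (ℤ.pos-+ 1 r)) (identity a (+ r))
    where
    identity : ∀ a r → a ℤ.- (+ 1 ℤ.+ r) ≡ a ℤ.- + 1 ℤ.- r
    identity = ℤ-Ring.solve-∀

-- Subtracting A modulo k + 1 is adding k · A.
%-shift : ∀ k {S A B K} → S + A ≡ K * suc k + B → S % suc k ≡ (B + k * A) % suc k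
%-shift k {S} {A} {B} {K} eq = begin
  S % suc k                          ≡⟨ sym ([m+kn]%n≡m%n S A (suc k)) ⟩
  (S + A * suc k) % suc k            ≡⟨ cong (_% suc k) rearranged ⟩
  (B + k * A + K * suc k) % suc k    ≡⟨ [m+kn]%n≡m%n (B + k * A) K (suc k) ⟩
  (B + k * A) % suc k                ∎
  where
  open ≡-Reasoning
  split : ∀ S A k → S + A * (1 + k) ≡ S + A + k * A
  split = ℕ-Ring.solve-∀
  regroup : ∀ K k B A → K * (1 + k) + B + k * A ≡ B + k * A + K * (1 + k)
  regroup = ℕ-Ring.solve-∀
  rearranged : S + A * suc k ≡ B + k * A + K * suc k
  rearranged = trans (split S A k) (trans (cong (_+ k * A) eq) (regroup K k B A))


two-suc : ∀ q → 2 * suc q ≡ 2 + 2 * q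
two-suc = ℕ-Ring.solve-∀

2+2q≢1+2r : ∀ q r → 2 + 2 * q ≢ 1 + 2 * r
2+2q≢1+2r q r eq = ℕ.even≢odd (suc q) r (trans (two-suc q) eq)

[2+2q]%2≡0 : ∀ q → (2 + 2 * q) % 2 ≡ 0
[2+2q]%2≡0 q = trans (cong (_% 2) (shape q)) (m*n%n≡0 (1 + q) 2)
  where
  shape : ∀ q → 2 + 2 * q ≡ (1 + q) * 2
  shape = ℕ-Ring.solve-∀

[3+2q]%2≡1 : ∀ q → (3 + 2 * q) % 2 ≡ 1
[3+2q]%2≡1 q = trans (cong (_% 2) (shape q)) ([m+kn]%n≡m%n 1 (1 + q) 2)
  where
  shape : ∀ q → 3 + 2 * q ≡ 1 + (1 + q) * 2
  shape = ℕ-Ring.solve-∀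

parity-even : ∀ e → parity (2 * e) ≡ 0ℙ
parity-even e = Parity.*-homo-* 2 e

parity-odd : ∀ e → parity (1 + 2 * e) ≡ 1ℙ
parity-odd e = trans (Parity.+-homo-+ 1 (2 * e)) (cong (1ℙ ℙ.+_) (parity-even e))

even⊎odd : ∀ k → (Σ ℕ λ e → k ≡ 2 * e) ⊎ (Σ ℕ λ e → k ≡ 1 + 2 * e)
even⊎odd zero          = inj₁ (0 , refl)
even⊎odd (suc zero)    = inj₂ (0 , refl)
even⊎odd (suc (suc k)) with even⊎odd k
... | inj₁ (e , refl) = inj₁ (suc e , sym (two-suc e))
... | inj₂ (e , refl) = inj₂ (suc e , two-more e)
  where
  two-more : ∀ e → 2 + (1 + 2 * e) ≡ 1 + 2 * suc e
  two-more = ℕ-Ring.solve-∀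


Σ< : ℕ → (ℕ → ℕ) → ℕ
Σ< zero    f = 0
Σ< (suc N) f = f 0 + Σ< N (f ∘ suc)

Σ<-cong : ∀ N {f g : ℕ → ℕ} → (∀ k → f k ≡ g k) → Σ< N f ≡ Σ< N g
Σ<-cong zero    f≗g = refl
Σ<-cong (suc N) f≗g = cong₂ _+_ (f≗g 0) (Σ<-cong N (f≗g ∘ suc))

sum-allFin : ∀ N (f : ℕ → ℕ) → sum (map (f ∘ toℕ) (allFin N)) ≡ Σ< N f
sum-allFin N f = trans (cong sum (List.map-tabulate {n = N} (λ i → i) (f ∘ toℕ))) (go N f)
  where
  go : ∀ N (f : ℕ → ℕ) → sum (List.tabulate {n = N} (f ∘ toℕ)) ≡ Σ< N f
  go zero    f = refl
  go (suc N) f = cong (λ t → f 0 + t) (go N (f ∘ suc))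

Σ<-replace : ∀ N {a} {f g : ℕ → ℕ} → a < N → (∀ k → k ≢ a → f k ≡ g k) → Σ< N f + g a ≡ Σ< N g + f a
Σ<-replace (suc N) {zero} {f} {g} _ agree = begin
  f 0 + Σ< N (f ∘ suc) + g 0  ≡⟨ cong (λ t → f 0 + t + g 0) (Σ<-cong N (λ k → agree (suc k) (λ ()))) ⟩
  f 0 + Σ< N (g ∘ suc) + g 0  ≡⟨ swap-ends (f 0) (Σ< N (g ∘ suc)) (g 0) ⟩
  g 0 + Σ< N (g ∘ suc) + f 0  ∎
  where
  open ≡-Reasoning
  swap-ends : ∀ a b c → a + b + c ≡ c + b + a
  swap-ends = ℕ-Ring.solve-∀
Σ<-replace (suc N) {suc a} {f} {g} (s≤s a<N) agree = begin
  f 0 + Σ< N (f ∘ suc) + g (suc a)    ≡⟨ ℕ.+-assoc (f 0) _ _ ⟩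
  f 0 + (Σ< N (f ∘ suc) + g (suc a))  ≡⟨ cong₂ _+_ (agree 0 (λ ())) (Σ<-replace N a<N (λ k k≢a → agree (suc k) (k≢a ∘ ℕ.suc-injective))) ⟩
  g 0 + (Σ< N (g ∘ suc) + f (suc a))  ≡⟨ ℕ.+-assoc (g 0) _ _ ⟨
  g 0 + Σ< N (g ∘ suc) + f (suc a)    ∎
  where open ≡-Reasoning

+-telescope : ∀ {S₀ S₁ S₂ a b c d} → S₀ + a ≡ S₁ + b → S₁ + c ≡ S₂ + d → S₀ + (a + c) ≡ S₂ + (b + d)
+-telescope {S₀} {S₁} {S₂} {a} {b} {c} {d} step₁ step₂ = begin
  S₀ + (a + c)   ≡⟨ ℕ.+-assoc S₀ a c ⟨
  S₀ + a + c     ≡⟨ cong (_+ c) step₁ ⟩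
  S₁ + b + c     ≡⟨ ℕ.+-assoc S₁ b c ⟩
  S₁ + (b + c)   ≡⟨ cong (λ t → S₁ + t) (ℕ.+-comm b c) ⟩
  S₁ + (c + b)   ≡⟨ ℕ.+-assoc S₁ c b ⟨
  S₁ + c + b     ≡⟨ cong (_+ b) step₂ ⟩
  S₂ + d + b     ≡⟨ ℕ.+-assoc S₂ d b ⟩
  S₂ + (d + b)   ≡⟨ cong (λ t → S₂ + t) (ℕ.+-comm d b) ⟩
  S₂ + (b + d)   ∎
  where open ≡-Reasoning

infixl 6 _[_≔_]

_[_≔_] : {A : Set} → (ℕ → A) → ℕ → A → ℕ → A
(f [ a ≔ c ]) k with k ≟ a
... | yes _ = c
... | no  _ = f k

module _ {A : Set} (f : ℕ → A) (a : ℕ) (c : A) where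

  update-same : (f [ a ≔ c ]) a ≡ c
  update-same with a ≟ a
  ... | yes _   = refl
  ... | no  a≢a = contradiction refl a≢a

  update-other : ∀ {k} → k ≢ a → (f [ a ≔ c ]) k ≡ f k
  update-other {k} k≢a with k ≟ a
  ... | yes k≡a = contradiction k≡a k≢a
  ... | no  _   = refl

  update-preserves : ∀ {P : A → Set} → P c → (∀ k → P (f k)) → ∀ k → P ((f [ a ≔ c ]) k)
  update-preserves Pc Pf k with k ≟ a
  ... | yes _ = Pc
  ... | no  _ = Pf k

  Σ<-update : ∀ N (g : A → ℕ) → a < N → Σ< N (g ∘ (f [ a ≔ c ])) + g (f a) ≡ Σ< N (g ∘ f) + g c
  Σ<-update N g a<N = subst (λ t → Σ< N (g ∘ (f [ a ≔ c ])) + g (f a) ≡ Σ< N (g ∘ f) + g t) update-same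
    (Σ<-replace N a<N (λ k k≢a → cong g (update-other k≢a)))


module _ {A B : Set} (f : A → List B) where

  concatMap-vanishes : ∀ {xs} → (∀ {a} → a ∈ xs → f a ≡ []) → concatMap f xs ≡ []
  concatMap-vanishes {[]}     _      = refl
  concatMap-vanishes {a ∷ xs} vanish = cong₂ _++_ (vanish (here refl)) (concatMap-vanishes (vanish ∘ there))

  concatMap-single : ∀ {xs c} → Unique xs → c ∈ xs → (∀ {a} → a ∈ xs → a ≢ c → f a ≡ []) → concatMap f xs ≡ f c
  concatMap-single {c ∷ xs} (c∉ ∷ _) (here refl) vanish =
    trans (cong (f c ++_) (concatMap-vanishes (λ a∈ → vanish (there a∈) (All.lookup c∉ a∈ ∘ sym))))
          (List.++-identityʳ (f c))
  concatMap-single {a ∷ xs} (a∉ ∷ u) (there c∈) vanish =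
    cong₂ _++_ (vanish (here refl) (All.lookup a∉ c∈)) (concatMap-single u c∈ (vanish ∘ there))

  concatMap-pair : ∀ {xs c₁ c₂} → Unique xs → c₁ ∈ xs → c₂ ∈ xs → c₁ ≢ c₂ →
                   (∀ {a} → a ∈ xs → a ≢ c₁ → a ≢ c₂ → f a ≡ []) → concatMap f xs ↭ f c₁ ++ f c₂
  concatMap-pair (_ ∷ _) (here refl) (here refl) c₁≢c₂ _ = contradiction refl c₁≢c₂
  concatMap-pair {c₁ ∷ xs} (c₁∉ ∷ u) (here refl) (there c₂∈) _ vanish =
    ↭-reflexive (cong (f c₁ ++_) (concatMap-single u c₂∈ (λ a∈ → vanish (there a∈) (All.lookup c₁∉ a∈ ∘ sym))))
  concatMap-pair {c₂ ∷ xs} {c₁} (c₂∉ ∷ u) (there c₁∈) (here refl) _ vanish =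
    ↭-trans (↭-reflexive (cong (f c₂ ++_) (concatMap-single u c₁∈ (λ a∈ a≢c₁ → vanish (there a∈) a≢c₁ (All.lookup c₂∉ a∈ ∘ sym)))))
            (++-comm (f c₂) (f c₁))
  concatMap-pair {a ∷ xs} {c₁} {c₂} (a∉ ∷ u) (there c₁∈) (there c₂∈) c₁≢c₂ vanish =
    subst (λ t → t ++ concatMap f xs ↭ f c₁ ++ f c₂) (sym (vanish (here refl) (All.lookup a∉ c₁∈) (All.lookup a∉ c₂∈)))
          (concatMap-pair u c₁∈ c₂∈ c₁≢c₂ (vanish ∘ there))

↭-by-sorting : ∀ {xs ys : List (Fin 6)} → sort xs ≡ sort ys → xs ↭ ys
↭-by-sorting {xs} {ys} same = ↭-trans (↭-sym (sort-↭ xs)) (subst (_↭ ys) (sym same) (sort-↭ ys))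


-- Columns covering an edge

neg6-involutive : ∀ a → neg6 (neg6 a) ≡ a
neg6-involutive zero                                = refl
neg6-involutive (suc zero)                          = refl
neg6-involutive (suc (suc zero))                    = refl
neg6-involutive (suc (suc (suc zero)))              = refl
neg6-involutive (suc (suc (suc (suc zero))))        = refl
neg6-involutive (suc (suc (suc (suc (suc zero))))) = refl

neg6-permutes : map neg6 (allFin 6) ↭ allFin 6
neg6-permutes = ↭-by-sorting refl

allCols≡cartesianProduct : ∀ x → allCols x ≡ cartesianProduct (allFin (x ∸ 1)) (allFin x)
allCols≡cartesianProduct x = go (allFin (x ∸ 1))
  where
  go : ∀ js → concatMap (λ j → map (j ,_) (allFin x)) js ≡ cartesianProduct js (allFin x)
  go []       = refl
  go (j ∷ js) = cong (map (j ,_) (allFin x) ++_) (go js)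

module Incidence {x : ℕ} (T : Matrices x) where

  Column : Set
  Column = Fin (x ∸ 1) × Fin x

  Joins : Column → Pt → Pt → Set
  Joins (j , i) u v = colHead x j i ≡ u × colTail x j i ≡ v

  Covers : Pt → Pt → Column → Set
  Covers u v c = Joins c u v ⊎ Joins c v u

  entriesAt : Column → List Z6
  entriesAt (j , i) = map (λ r → T j r i) (allFin 3)

  forward : ∀ {u v} c → Joins c u v → incident x u v c ≡ 0 ∷ [] × crossDiffs x T u v c ≡ entriesAt c
  forward {u} {v} (j , i) (hu , hv) with ≡-dec _≟_ (colHead x j i) u | ≡-dec _≟_ (colTail x j i) v
  ... | yes _   | yes _   = refl , refl
  ... | no ¬hu  | _       = contradiction hu ¬hu
  ... | yes _   | no ¬hv  = contradiction hv ¬hv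

  backward : ∀ {u v} c → u ≢ v → Joins c v u → incident x u v c ≡ 0 ∷ [] × crossDiffs x T u v c ≡ map neg6 (entriesAt c)
  backward {u} {v} (j , i) u≢v (hv , hu) with ≡-dec _≟_ (colHead x j i) u | ≡-dec _≟_ (colTail x j i) v
                                            | ≡-dec _≟_ (colHead x j i) v | ≡-dec _≟_ (colTail x j i) u
  ... | yes hu′ | yes _  | _      | _      = contradiction (trans (sym hu′) hv) u≢v
  ... | yes _   | no _   | yes _  | yes _  = refl , sym (List.map-∘ {g = neg6} {f = λ r → T j r i} (allFin 3))
  ... | no _    | _      | yes _  | yes _  = refl , sym (List.map-∘ {g = neg6} {f = λ r → T j r i} (allFin 3))
  ... | _       | _      | no ¬hv | _      = contradiction hv ¬hv
  ... | yes _   | no _   | yes _  | no ¬hu = contradiction hu ¬hu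
  ... | no _    | _      | yes _  | no ¬hu = contradiction hu ¬hu

  unrelated : ∀ {u v} c → ¬ Covers u v c → incident x u v c ≡ [] × crossDiffs x T u v c ≡ []
  unrelated {u} {v} (j , i) ¬covers with ≡-dec _≟_ (colHead x j i) u | ≡-dec _≟_ (colTail x j i) v
                                        | ≡-dec _≟_ (colHead x j i) v | ≡-dec _≟_ (colTail x j i) u
  ... | yes hu | yes hv | _      | _      = contradiction (inj₁ (hu , hv)) ¬covers
  ... | yes _  | no _   | yes hv | yes hu = contradiction (inj₂ (hv , hu)) ¬covers
  ... | yes _  | no _   | yes _  | no _   = refl , refl
  ... | yes _  | no _   | no _   | _      = refl , refl
  ... | no _   | _      | yes hv | yes hu = contradiction (inj₂ (hv , hu)) ¬covers
  ... | no _   | _      | yes _  | no _   = refl , refl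
  ... | no _   | _      | no _   | _      = refl , refl

  record Cover (u v : Pt) : Set where
    field
      c₁ c₂         : Column
      c₁≢c₂         : c₁ ≢ c₂
      covers₁       : Covers u v c₁
      covers₂       : Covers u v c₂
      only          : ∀ c → Covers u v c → c ≡ c₁ ⊎ c ≡ c₂
      complementary : crossDiffs x T u v c₁ ++ crossDiffs x T u v c₂ ↭ allFin 6

  crossDiffs-flip : ∀ {u v} c → u ≢ v → Covers u v c → crossDiffs x T v u c ≡ map neg6 (crossDiffs x T u v c)
  crossDiffs-flip c u≢v (inj₁ joins) = begin
    crossDiffs x T _ _ c            ≡⟨ proj₂ (backward c (u≢v ∘ sym) joins) ⟩
    map neg6 (entriesAt c)          ≡⟨ cong (map neg6) (proj₂ (forward c joins)) ⟨
    map neg6 (crossDiffs x T _ _ c) ∎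
    where open ≡-Reasoning
  crossDiffs-flip c u≢v (inj₂ joins) = begin
    crossDiffs x T _ _ c                     ≡⟨ proj₂ (forward c joins) ⟩
    entriesAt c                              ≡⟨ List.map-id-local {f = neg6 ∘ neg6} (All.universal neg6-involutive _) ⟨
    map (neg6 ∘ neg6) (entriesAt c)          ≡⟨ List.map-∘ {g = neg6} {f = neg6} (entriesAt c) ⟩
    map neg6 (map neg6 (entriesAt c))        ≡⟨ cong (map neg6) (proj₂ (backward c u≢v joins)) ⟨
    map neg6 (crossDiffs x T _ _ c)          ∎
    where open ≡-Reasoning

  Cover-sym : ∀ {u v} → u ≢ v → Cover u v → Cover v u
  Cover-sym {u} {v} u≢v cover = record
    { c₁ = c₁ ; c₂ = c₂ ; c₁≢c₂ = c₁≢c₂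
    ; covers₁ = swap covers₁ ; covers₂ = swap covers₂
    ; only = λ c → only c ∘ swap
    ; complementary = ↭-trans (↭-reflexive flipped) (↭-trans (map⁺ neg6 complementary) neg6-permutes)
    }
    where
    open Cover cover
    swap : ∀ {A B : Set} → A ⊎ B → B ⊎ A
    swap (inj₁ a) = inj₂ a
    swap (inj₂ b) = inj₁ b
    flipped : crossDiffs x T v u c₁ ++ crossDiffs x T v u c₂ ≡ map neg6 (crossDiffs x T u v c₁ ++ crossDiffs x T u v c₂)
    flipped = trans (cong₂ _++_ (crossDiffs-flip c₁ u≢v covers₁) (crossDiffs-flip c₂ u≢v covers₂))
                    (sym (List.map-++ neg6 (crossDiffs x T u v c₁) _))

  Cover⇒edge-condition : ∀ {u v} → u ≢ v → Cover u v →
    (length (incidentCols x u v) ≡ 2) × (concatMap (crossDiffs x T u v) (allCols x) ↭ allFin 6)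
  Cover⇒edge-condition {u} {v} u≢v cover =
    length≡2 , ↭-trans (supported (crossDiffs x T u v) (λ c ¬covers → proj₂ (unrelated c ¬covers))) complementary
    where
    open Cover cover
    allCols-unique : Unique (allCols x)
    allCols-unique = subst Unique (sym (allCols≡cartesianProduct x)) (cartesianProduct⁺ (allFin⁺ (x ∸ 1)) (allFin⁺ x))
    ∈-allCols : ∀ c → c ∈ allCols x
    ∈-allCols (j , i) = subst ((j , i) ∈_) (sym (allCols≡cartesianProduct x)) (∈-cartesianProduct⁺ (∈-allFin j) (∈-allFin i))
    uncovered : ∀ {c} → c ≢ c₁ → c ≢ c₂ → ¬ Covers u v c
    uncovered c≢c₁ c≢c₂ covers with only _ covers
    ... | inj₁ c≡c₁ = c≢c₁ c≡c₁
    ... | inj₂ c≡c₂ = c≢c₂ c≡c₂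
    supported : ∀ {B : Set} (f : Column → List B) → (∀ c → ¬ Covers u v c → f c ≡ []) → concatMap f (allCols x) ↭ f c₁ ++ f c₂
    supported f vanish = concatMap-pair f allCols-unique (∈-allCols c₁) (∈-allCols c₂) c₁≢c₂
      (λ {c} _ c≢c₁ c≢c₂ → vanish c (uncovered c≢c₁ c≢c₂))
    incidence : Column → List Column
    incidence c = map (λ _ → c) (incident x u v c)
    once : ∀ c → Covers u v c → length (incidence c) ≡ 1
    once c (inj₁ joins) = cong (length ∘ map (λ _ → c)) (proj₁ (forward c joins))
    once c (inj₂ joins) = cong (length ∘ map (λ _ → c)) (proj₁ (backward c u≢v joins))
    length≡2 : length (incidentCols x u v) ≡ 2
    length≡2 = begin
      length (incidentCols x u v)                  ≡⟨ ↭-length (supported incidence (λ c ¬covers → cong (map (λ _ → c)) (proj₁ (unrelated c ¬covers)))) ⟩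
      length (incidence c₁ ++ incidence c₂)        ≡⟨ List.length-++ (incidence c₁) ⟩
      length (incidence c₁) + length (incidence c₂) ≡⟨ cong₂ _+_ (once c₁ covers₁) (once c₂ covers₂) ⟩
      2                                            ∎
      where open ≡-Reasoning


-- Columns of the matrices

Triple : Set
Triple = Z6 × Z6 × Z6

entry : Triple → Fin 3 → Z6
entry (a , _ , _) zero             = a
entry (_ , b , _) (suc zero)       = b
entry (_ , _ , c) (suc (suc zero)) = c

entries : Triple → List Z6
entries t = map (entry t) (allFin 3)

Distinct : Triple → Set
Distinct t = ∀ r s → entry t r ≡ entry t s → r ≡ s

distinct : ∀ {a b c} → a ≢ b → a ≢ c → b ≢ c → Distinct (a , b , c)
distinct a≢b a≢c b≢c zero             zero             _ = refl
distinct a≢b a≢c b≢c zero             (suc zero)       e = contradiction e a≢b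
distinct a≢b a≢c b≢c zero             (suc (suc zero)) e = contradiction e a≢c
distinct a≢b a≢c b≢c (suc zero)       zero             e = contradiction (sym e) a≢b
distinct a≢b a≢c b≢c (suc zero)       (suc zero)       _ = refl
distinct a≢b a≢c b≢c (suc zero)       (suc (suc zero)) e = contradiction e b≢c
distinct a≢b a≢c b≢c (suc (suc zero)) zero             e = contradiction (sym e) a≢c
distinct a≢b a≢c b≢c (suc (suc zero)) (suc zero)       e = contradiction (sym e) b≢c
distinct a≢b a≢c b≢c (suc (suc zero)) (suc (suc zero)) _ = refl

EvenTriple OddTriple : Triple → Set
EvenTriple t = entries t ↭ # 0 ∷ # 2 ∷ # 4 ∷ []
OddTriple  t = entries t ↭ # 1 ∷ # 3 ∷ # 5 ∷ []

even-odd-complementary : ∀ {a b} → EvenTriple a → OddTriple b → entries a ++ entries b ↭ allFin 6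
even-odd-complementary a-even b-odd = ↭-trans (++⁺ a-even b-odd) (↭-by-sorting refl)

periodic : ℕ → Triple
periodic 0 = # 4 , # 0 , # 2
periodic 1 = # 1 , # 3 , # 5
periodic 2 = # 2 , # 0 , # 4
periodic 3 = # 5 , # 3 , # 1
periodic (suc (suc (suc (suc k)))) = periodic k

periodic-distinct : ∀ k → Distinct (periodic k)
periodic-distinct 0 = distinct (λ ()) (λ ()) (λ ())
periodic-distinct 1 = distinct (λ ()) (λ ()) (λ ())
periodic-distinct 2 = distinct (λ ()) (λ ()) (λ ())
periodic-distinct 3 = distinct (λ ()) (λ ()) (λ ())
periodic-distinct (suc (suc (suc (suc k)))) = periodic-distinct k

periodic-even : ∀ e → EvenTriple (periodic (2 * e))
periodic-even 0 = ↭-by-sorting refl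
periodic-even 1 = ↭-by-sorting refl
periodic-even (suc (suc e)) = subst (EvenTriple ∘ periodic) (four-more e) (periodic-even e)
  where
  four-more : ∀ e → 4 + 2 * e ≡ 2 * (2 + e)
  four-more = ℕ-Ring.solve-∀

periodic-odd : ∀ e → OddTriple (periodic (1 + 2 * e))
periodic-odd 0 = ↭-by-sorting refl
periodic-odd 1 = ↭-by-sorting refl
periodic-odd (suc (suc e)) = subst (OddTriple ∘ periodic) (four-more e) (periodic-odd e)
  where
  four-more : ∀ e → 4 + (1 + 2 * e) ≡ 1 + 2 * (2 + e)
  four-more = ℕ-Ring.solve-∀

periodic-period : ∀ r k → periodic (r + 4 * k) ≡ periodic r
periodic-period r zero    = cong periodic (ℕ.+-identityʳ r)
periodic-period r (suc k) = trans (cong periodic (four-more r k)) (periodic-period r k)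
  where
  four-more : ∀ r k → r + 4 * suc k ≡ 4 + (r + 4 * k)
  four-more = ℕ-Ring.solve-∀

rowOf : Fin 3 → Triple → ℕ
rowOf r t = toℕ (entry t r)

weight : Fin 3 → ℕ
weight zero             = 2
weight (suc zero)       = 1
weight (suc (suc zero)) = 2

Σ-periodic : ∀ k r → Σ< (4 + 4 * k) (rowOf r ∘ periodic) ≡ suc k * weight r * 6
Σ-periodic zero    zero             = refl
Σ-periodic zero    (suc zero)       = refl
Σ-periodic zero    (suc (suc zero)) = refl
Σ-periodic (suc k) r = trans (cong (λ N → Σ< N (rowOf r ∘ periodic)) (four-more k)) (one-more r)
  where
  four-more : ∀ k → 4 + 4 * suc k ≡ 4 + (4 + 4 * k)
  four-more = ℕ-Ring.solve-∀
  one-more : ∀ r → Σ< (4 + (4 + 4 * k)) (rowOf r ∘ periodic) ≡ suc (suc k) * weight r * 6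
  one-more zero             = cong (λ t → 12 + t) (Σ-periodic k zero)
  one-more (suc zero)       = cong (λ t → 6 + t) (Σ-periodic k (suc zero))
  one-more (suc (suc zero)) = cong (λ t → 12 + t) (Σ-periodic k (suc (suc zero)))


c0-even : ∀ x q → c0 x (2 + 2 * q) ≡ just q
c0-even x q with (2 + 2 * q) % 2 | [2+2q]%2≡0 q
... | .0 | refl = cong just (begin
  (2 + 2 * q) ∸ (2 + 2 * q + 2) / 2  ≡⟨ cong (λ t → (2 + 2 * q) ∸ t / 2) (halvable q) ⟩
  (2 + 2 * q) ∸ (2 + q) * 2 / 2      ≡⟨ cong ((2 + 2 * q) ∸_) (m*n/n≡m (2 + q) 2) ⟩
  (2 + 2 * q) ∸ (2 + q)              ≡⟨ cong (_∸ (2 + q)) (split q) ⟩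
  q + (2 + q) ∸ (2 + q)              ≡⟨ ℕ.m+n∸n≡m q (2 + q) ⟩
  q                                  ∎)
  where
  open ≡-Reasoning
  halvable : ∀ q → 2 + 2 * q + 2 ≡ (2 + q) * 2
  halvable = ℕ-Ring.solve-∀
  split : ∀ q → 2 + 2 * q ≡ q + (2 + q)
  split = ℕ-Ring.solve-∀

c0-odd : ∀ x q → c0 x (3 + 2 * q) ≡ just (x ∸ (2 + q))
c0-odd x q with (3 + 2 * q) % 2 | [3+2q]%2≡1 q
... | .1 | refl = cong (λ t → just (x ∸ t)) (trans (cong (_/ 2) (halvable q)) (m*n/n≡m (2 + q) 2))
  where
  halvable : ∀ q → 3 + 2 * q + 1 ≡ (2 + q) * 2
  halvable = ℕ-Ring.solve-∀


module Construction (m : ℕ) where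

  x n h lastIndex : ℕ
  x = 4 + 4 * m
  n = 3 + 4 * m
  h = 1 + 2 * m
  lastIndex = 2 + 4 * m

  n≡1+2h : n ≡ 1 + 2 * h
  n≡1+2h = identity m
    where
    identity : ∀ m → 3 + 4 * m ≡ 1 + 2 * (1 + 2 * m)
    identity = ℕ-Ring.solve-∀

  x≡2+2h : x ≡ 2 + 2 * h
  x≡2+2h = identity m
    where
    identity : ∀ m → 4 + 4 * m ≡ 2 + 2 * (1 + 2 * m)
    identity = ℕ-Ring.solve-∀

  lastIndex≡2h : lastIndex ≡ 2 * h
  lastIndex≡2h = identity m
    where
    identity : ∀ m → 2 + 4 * m ≡ 2 * (1 + 2 * m)
    identity = ℕ-Ring.solve-∀

  H : ℤ
  H = + h

  n≡2H+1 : + n ≡ + 2 ℤ.* H ℤ.+ + 1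
  n≡2H+1 = trans (cong +_ (trans n≡1+2h (ℕ.+-comm 1 (2 * h)))) (trans (ℤ.pos-+ (2 * h) 1) (cong (ℤ._+ + 1) (ℤ.pos-* 2 h)))

  ∣-combine : ∀ {a b z} (c d e : ℤ) → z ≡ c ℤ.* a ℤ.+ d ℤ.* b ℤ.+ e ℤ.* (+ 2 ℤ.* H ℤ.+ + 1) →
              + n ∣ a → + n ∣ b → + n ∣ z
  ∣-combine {a} {b} c d e z≡ = ∣-linear c d e (trans z≡ (cong (λ t → c ℤ.* a ℤ.+ d ℤ.* b ℤ.+ e ℤ.* t) (sym n≡2H+1)))

  ∣0 : + n ∣ 0ℤ
  ∣0 = divides 0ℤ refl

  -- n = 2h + 1 is odd, so 2 is invertible modulo n.
  ∣-half : ∀ {z} → + n ∣ + 2 ℤ.* z → + n ∣ z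
  ∣-half {z} n∣2z = ∣-combine (ℤ.- H) 0ℤ z (halving H z) n∣2z ∣0
    where
    halving : ∀ H z → z ≡ ℤ.- H ℤ.* (+ 2 ℤ.* z) ℤ.+ 0ℤ ℤ.* 0ℤ ℤ.+ z ℤ.* (+ 2 ℤ.* H ℤ.+ + 1)
    halving = ℤ-Ring.solve-∀

  -- Edges of the cycles D_J

  shift : ℕ → ℕ → ℕ
  shift J a = (a + (J * (x ∸ 2)) / 2) % n

  half-step : ∀ J → (J * (x ∸ 2)) / 2 ≡ J * h
  half-step J = trans (cong (_/ 2) (double J m)) (m*n/n≡m (J * h) 2)
    where
    double : ∀ J m → J * (2 + 4 * m) ≡ J * (1 + 2 * m) * 2
    double = ℕ-Ring.solve-∀

  -- u ≡ a + J h (mod n): the offset a of C₀ is the vertex u of D_J.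
  ShiftsTo : ℕ → ℤ → ℕ → Set
  ShiftsTo J a u = + n ∣ a ℤ.+ + J ℤ.* H ℤ.- + u

  shift-exact : ∀ J a → + (a + (J * (x ∸ 2)) / 2) ≡ + a ℤ.+ + J ℤ.* H
  shift-exact J a = trans (ℤ.pos-+ a _) (cong (λ t → + a ℤ.+ t) (trans (cong +_ (half-step J)) (ℤ.pos-* J h)))

  shift⇒ShiftsTo : ∀ {J a u} → shift J a ≡ u → ShiftsTo J (+ a) u
  shift⇒ShiftsTo {J} {a} refl = subst (λ t → + n ∣ t ℤ.- + shift J a) (shift-exact J a) (%ℕ-∣ n (+ (a + (J * (x ∸ 2)) / 2)))

  ShiftsTo⇒shift : ∀ {J a u} → u < n → ShiftsTo J (+ a) u → shift J a ≡ u
  ShiftsTo⇒shift {J} {a} u<n n∣ = %ℕ-unique n (+ (a + (J * (x ∸ 2)) / 2)) u<n (subst (λ t → + n ∣ t ℤ.- + _) (sym (shift-exact J a)) n∣)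

  2+2q<n : ∀ {q} → q < h → 2 + 2 * q < n
  2+2q<n {q} q<h = subst (2 + 2 * q <_) (sym n≡1+2h) (s≤s (subst (_≤ 2 * h) (two-suc q) (ℕ.*-monoʳ-≤ 2 q<h)))

  2+2q<n⁻¹ : ∀ {q} → 2 + 2 * q < n → q < h
  2+2q<n⁻¹ {q} lt = ℕ.*-cancelˡ-≤ 2 (subst (_≤ 2 * h) (sym (two-suc q)) (ℕ.≤-pred (subst (2 + 2 * q <_) n≡1+2h lt)))

  1+2q<n⁻¹ : ∀ {q} → 1 + 2 * q < n → q < h
  1+2q<n⁻¹ {q} lt = ℕ.*-cancelˡ-< 2 q h (ℕ.≤-pred (subst (1 + 2 * q <_) n≡1+2h lt))

  1+2q<n : ∀ {q} → q < h → 1 + 2 * q < n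
  1+2q<n q<h = ℕ.<-trans (ℕ.n<1+n _) (2+2q<n q<h)

  data Position (k : ℕ) : Set where
    start   : k ≡ 0 → Position k
    evenPos : ∀ q → q < h → k ≡ 2 + 2 * q → Position k
    oddPos  : ∀ q → q < h → k ≡ 1 + 2 * q → Position k
    end     : k ≡ n → Position k

  position : ∀ {k} → k < x → Position k
  position {k} k<x with even⊎odd k
  ... | inj₁ (zero , refl)  = start refl
  ... | inj₁ (suc q , refl) = evenPos q q<h (two-suc q)
    where
    q<h : q < h
    q<h = ℕ.≤-pred (ℕ.*-cancelˡ-< 2 (suc q) (suc h) (subst (2 * suc q <_) x≡2[1+h] k<x))
      where
      x≡2[1+h] : x ≡ 2 * suc h
      x≡2[1+h] = trans x≡2+2h (sym (two-suc h))
  ... | inj₂ (e , refl) with ℕ.<-cmp e h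
  ...   | tri< e<h _ _    = oddPos e e<h refl
  ...   | tri≈ _ refl _   = end (sym n≡1+2h)
  ...   | tri> _ _ h<e    = contradiction k<x (ℕ.≤⇒≯ x≤k)
    where
    x≤k : x ≤ 1 + 2 * e
    x≤k = ℕ.≤-trans (ℕ.≤-reflexive (trans x≡2+2h (sym (two-suc h)))) (ℕ.≤-trans (ℕ.*-monoʳ-≤ 2 h<e) (ℕ.n≤1+n _))

  module _ (j : Fin n) (i : Fin x) where

    private
      J = toℕ j

      finite-entry : ∀ k {a} → c0 x k ≡ just a → D x J k ≡ just (shift J a)
      finite-entry _ c0≡ = cong (Maybe.map (shift J)) c0≡

      successor : ∀ {k} → toℕ i ≡ k → k < n → suc (modN (suc (toℕ i)) x) ≡ 2 + k
      successor refl k<n = cong suc (m<n⇒m%n≡m (s≤s k<n))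

    start-ends : toℕ i ≡ 0 → colHead x j i ≡ nothing × colTail x j i ≡ just (shift J 0)
    start-ends i≡0 = cong (D x J ∘ suc) i≡0 , cong (D x J) (successor i≡0 (s≤s z≤n))

    even-ends : ∀ {q} → q < h → toℕ i ≡ 2 + 2 * q →
                colHead x j i ≡ just (shift J (x ∸ (2 + q))) × colTail x j i ≡ just (shift J (1 + q))
    even-ends {q} q<h i≡ =
      trans (cong (D x J ∘ suc) i≡) (finite-entry (3 + 2 * q) (c0-odd x q)) ,
      trans (cong (D x J) (trans (successor i≡ (2+2q<n q<h)) (cong (λ t → 2 + t) (sym (two-suc q))))) (finite-entry (2 + 2 * suc q) (c0-even x (suc q)))

    odd-ends : ∀ {q} → q < h → toℕ i ≡ 1 + 2 * q →
               colHead x j i ≡ just (shift J q) × colTail x j i ≡ just (shift J (x ∸ (2 + q)))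
    odd-ends {q} q<h i≡ =
      trans (cong (D x J ∘ suc) i≡) (finite-entry (2 + 2 * q) (c0-even x q)) ,
      trans (cong (D x J) (successor i≡ (1+2q<n q<h))) (finite-entry (3 + 2 * q) (c0-odd x q))

    end-ends : toℕ i ≡ n → colHead x j i ≡ just (shift J h) × colTail x j i ≡ nothing
    end-ends i≡n =
      trans (cong (D x J ∘ suc) i≡n) (finite-entry x (trans (cong (c0 x) x≡2+2h) (c0-even x h))) ,
      cong (D x J ∘ suc) (trans (cong (λ k → modN (suc k) x) i≡n) (n%n≡0 x))

  -- The matrices holding the even-position and the odd-position column of an edge with
  -- endpoint sum s (s = 2w for the edge {∞, w}).
  evenCycle oddCycle : ℤ → ℕ
  evenCycle s = (ℤ.- s) %ℕ n
  oddCycle  s = (ℤ.- s ℤ.- + 1) %ℕ n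

  gap : ℕ → ℕ → ℕ
  gap u v = (+ v ℤ.- + u) %ℕ n

  -- The odd position 1 + 2 · mirror q and the even position 2 + 2q add up to n.
  mirror : ℕ → ℕ
  mirror q = h ∸ suc q

  mirror<h : ∀ q → mirror q < h
  mirror<h q = s≤s (ℕ.m∸n≤m (2 * m) q)

  h≡1+q+mirror : ∀ {q} → q < h → h ≡ suc q + mirror q
  h≡1+q+mirror q<h = sym (ℕ.m+[n∸m]≡n q<h)

  +mirror : ∀ {q} → q < h → + mirror q ≡ H ℤ.- + 1 ℤ.- + q
  +mirror {q} q<h = trans (trans (sym (ℤ.⊖-≥ q<h)) (sym (ℤ.m-n≡m⊖n h (suc q))))
                          (trans (cong (λ t → H ℤ.- t) (ℤ.pos-+ 1 q)) (split H (+ q)))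
    where
    split : ∀ H q → H ℤ.- (+ 1 ℤ.+ q) ≡ H ℤ.- + 1 ℤ.- q
    split = ℤ-Ring.solve-∀

  +far : ∀ {q} → q < h → + (x ∸ (2 + q)) ≡ + 2 ℤ.* H ℤ.- + q
  +far {q} q<h = begin
    + (x ∸ (2 + q))          ≡⟨ cong (λ t → + (t ∸ (2 + q))) x≡2+2h ⟩
    + (2 * h ∸ q)            ≡⟨ sym (ℤ.⊖-≥ q≤2h) ⟩
    2 * h ⊖ q                ≡⟨ sym (ℤ.m-n≡m⊖n (2 * h) q) ⟩
    + (2 * h) ℤ.- + q        ≡⟨ cong (ℤ._- + q) (ℤ.pos-* 2 h) ⟩
    + 2 ℤ.* H ℤ.- + q        ∎
    where
    open ≡-Reasoning
    q≤2h : q ≤ 2 * h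
    q≤2h = ℕ.≤-trans (ℕ.<⇒≤ q<h) (ℕ.m≤n*m h 2)

  private
    +even : ∀ q → + (2 + 2 * q) ≡ + 2 ℤ.+ + 2 ℤ.* + q
    +even q = trans (ℤ.pos-+ 2 (2 * q)) (cong (λ t → + 2 ℤ.+ t) (ℤ.pos-* 2 q))

    gap-∣ : ∀ u v q → gap u v ≡ 2 + 2 * q → + n ∣ + v ℤ.- + u ℤ.- (+ 2 ℤ.+ + 2 ℤ.* + q)
    gap-∣ u v q g≡ = subst (λ t → + n ∣ + v ℤ.- + u ℤ.- t) (trans (cong +_ g≡) (+even q)) (%ℕ-∣ n (+ v ℤ.- + u))

    gap-unique : ∀ u v {q} → q < h → + n ∣ + v ℤ.- + u ℤ.- (+ 2 ℤ.+ + 2 ℤ.* + q) → gap u v ≡ 2 + 2 * q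
    gap-unique u v {q} q<h n∣ = %ℕ-unique n (+ v ℤ.- + u) (2+2q<n q<h) (subst (λ t → + n ∣ + v ℤ.- + u ℤ.- t) (sym (+even q)) n∣)

  even-decode : ∀ {J q u v} → J < n → q < h → ShiftsTo J (+ 2 ℤ.* H ℤ.- + q) u → ShiftsTo J (+ 1 ℤ.+ + q) v →
                evenCycle (+ u ℤ.+ + v) ≡ J × gap u v ≡ 2 + 2 * q
  even-decode {J} {q} {u} {v} J<n q<h head tail =
    %ℕ-unique n (ℤ.- (+ u ℤ.+ + v)) J<n (∣-combine (+ 1) (+ 1) (ℤ.- (+ J ℤ.+ + 1)) (cycle H (+ J) (+ q) (+ u) (+ v)) head tail) ,
    gap-unique u v q<h (∣-combine (+ 1) (ℤ.- + 1) (ℤ.- + 1) (difference H (+ J) (+ q) (+ u) (+ v)) head tail)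
    where
    cycle : ∀ H J q u v → ℤ.- (u ℤ.+ v) ℤ.- J ≡ + 1 ℤ.* (+ 2 ℤ.* H ℤ.- q ℤ.+ J ℤ.* H ℤ.- u) ℤ.+ + 1 ℤ.* (+ 1 ℤ.+ q ℤ.+ J ℤ.* H ℤ.- v)
                                                  ℤ.+ ℤ.- (J ℤ.+ + 1) ℤ.* (+ 2 ℤ.* H ℤ.+ + 1)
    cycle = ℤ-Ring.solve-∀
    difference : ∀ H J q u v → v ℤ.- u ℤ.- (+ 2 ℤ.+ + 2 ℤ.* q) ≡ + 1 ℤ.* (+ 2 ℤ.* H ℤ.- q ℤ.+ J ℤ.* H ℤ.- u) ℤ.+ ℤ.- + 1 ℤ.* (+ 1 ℤ.+ q ℤ.+ J ℤ.* H ℤ.- v)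
                                                        ℤ.+ ℤ.- + 1 ℤ.* (+ 2 ℤ.* H ℤ.+ + 1)
    difference = ℤ-Ring.solve-∀

  odd-decode : ∀ {J q u v} → J < n → q < h → ShiftsTo J (+ q) u → ShiftsTo J (+ 2 ℤ.* H ℤ.- + q) v →
               oddCycle (+ u ℤ.+ + v) ≡ J × gap u v ≡ 2 + 2 * mirror q
  odd-decode {J} {q} {u} {v} J<n q<h head tail =
    %ℕ-unique n (ℤ.- (+ u ℤ.+ + v) ℤ.- + 1) J<n (∣-combine (+ 1) (+ 1) (ℤ.- (+ J ℤ.+ + 1)) (cycle H (+ J) (+ q) (+ u) (+ v)) head tail) ,
    gap-unique u v (mirror<h q)
      (subst (λ t → + n ∣ + v ℤ.- + u ℤ.- (+ 2 ℤ.+ + 2 ℤ.* t)) (sym (+mirror q<h))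
        (∣-combine (+ 1) (ℤ.- + 1) 0ℤ (difference H (+ J) (+ q) (+ u) (+ v)) head tail))
    where
    cycle : ∀ H J q u v → ℤ.- (u ℤ.+ v) ℤ.- + 1 ℤ.- J ≡ + 1 ℤ.* (q ℤ.+ J ℤ.* H ℤ.- u) ℤ.+ + 1 ℤ.* (+ 2 ℤ.* H ℤ.- q ℤ.+ J ℤ.* H ℤ.- v)
                                                         ℤ.+ ℤ.- (J ℤ.+ + 1) ℤ.* (+ 2 ℤ.* H ℤ.+ + 1)
    cycle = ℤ-Ring.solve-∀
    difference : ∀ H J q u v → v ℤ.- u ℤ.- (+ 2 ℤ.+ + 2 ℤ.* (H ℤ.- + 1 ℤ.- q)) ≡ + 1 ℤ.* (q ℤ.+ J ℤ.* H ℤ.- u) ℤ.+ ℤ.- + 1 ℤ.* (+ 2 ℤ.* H ℤ.- q ℤ.+ J ℤ.* H ℤ.- v)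
                                                                   ℤ.+ 0ℤ ℤ.* (+ 2 ℤ.* H ℤ.+ + 1)
    difference = ℤ-Ring.solve-∀

  even-encode : ∀ {q} u v → gap u v ≡ 2 + 2 * q →
                ShiftsTo (evenCycle (+ u ℤ.+ + v)) (+ 2 ℤ.* H ℤ.- + q) u × ShiftsTo (evenCycle (+ u ℤ.+ + v)) (+ 1 ℤ.+ + q) v
  even-encode {q} u v g≡ =
    ∣-half (∣-combine (+ 1) (+ 1) (J ℤ.+ + 2) (head H J (+ q) (+ u) (+ v)) cycle (gap-∣ u v q g≡)) ,
    ∣-half (∣-combine (+ 1) (ℤ.- + 1) J (tail H J (+ q) (+ u) (+ v)) cycle (gap-∣ u v q g≡))
    where
    J = + evenCycle (+ u ℤ.+ + v)
    cycle : + n ∣ ℤ.- (+ u ℤ.+ + v) ℤ.- J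
    cycle = %ℕ-∣ n (ℤ.- (+ u ℤ.+ + v))
    head : ∀ H J q u v → + 2 ℤ.* (+ 2 ℤ.* H ℤ.- q ℤ.+ J ℤ.* H ℤ.- u)
                         ≡ + 1 ℤ.* (ℤ.- (u ℤ.+ v) ℤ.- J) ℤ.+ + 1 ℤ.* (v ℤ.- u ℤ.- (+ 2 ℤ.+ + 2 ℤ.* q)) ℤ.+ (J ℤ.+ + 2) ℤ.* (+ 2 ℤ.* H ℤ.+ + 1)
    head = ℤ-Ring.solve-∀
    tail : ∀ H J q u v → + 2 ℤ.* (+ 1 ℤ.+ q ℤ.+ J ℤ.* H ℤ.- v)
                         ≡ + 1 ℤ.* (ℤ.- (u ℤ.+ v) ℤ.- J) ℤ.+ ℤ.- + 1 ℤ.* (v ℤ.- u ℤ.- (+ 2 ℤ.+ + 2 ℤ.* q)) ℤ.+ J ℤ.* (+ 2 ℤ.* H ℤ.+ + 1)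
    tail = ℤ-Ring.solve-∀

  odd-encode : ∀ {q} u v → q < h → gap u v ≡ 2 + 2 * q →
               ShiftsTo (oddCycle (+ u ℤ.+ + v)) (+ mirror q) u × ShiftsTo (oddCycle (+ u ℤ.+ + v)) (+ 2 ℤ.* H ℤ.- + mirror q) v
  odd-encode {q} u v q<h g≡ rewrite +mirror q<h =
    ∣-half (∣-combine (+ 1) (+ 1) (J ℤ.+ + 1) (head H J (+ q) (+ u) (+ v)) cycle (gap-∣ u v q g≡)) ,
    ∣-half (∣-combine (+ 1) (ℤ.- + 1) (J ℤ.+ + 1) (tail H J (+ q) (+ u) (+ v)) cycle (gap-∣ u v q g≡))
    where
    J = + oddCycle (+ u ℤ.+ + v)
    cycle : + n ∣ ℤ.- (+ u ℤ.+ + v) ℤ.- + 1 ℤ.- J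
    cycle = %ℕ-∣ n (ℤ.- (+ u ℤ.+ + v) ℤ.- + 1)
    head : ∀ H J q u v → + 2 ℤ.* (H ℤ.- + 1 ℤ.- q ℤ.+ J ℤ.* H ℤ.- u)
                         ≡ + 1 ℤ.* (ℤ.- (u ℤ.+ v) ℤ.- + 1 ℤ.- J) ℤ.+ + 1 ℤ.* (v ℤ.- u ℤ.- (+ 2 ℤ.+ + 2 ℤ.* q)) ℤ.+ (J ℤ.+ + 1) ℤ.* (+ 2 ℤ.* H ℤ.+ + 1)
    head = ℤ-Ring.solve-∀
    tail : ∀ H J q u v → + 2 ℤ.* (+ 2 ℤ.* H ℤ.- (H ℤ.- + 1 ℤ.- q) ℤ.+ J ℤ.* H ℤ.- v)
                         ≡ + 1 ℤ.* (ℤ.- (u ℤ.+ v) ℤ.- + 1 ℤ.- J) ℤ.+ ℤ.- + 1 ℤ.* (v ℤ.- u ℤ.- (+ 2 ℤ.+ + 2 ℤ.* q)) ℤ.+ (J ℤ.+ + 1) ℤ.* (+ 2 ℤ.* H ℤ.+ + 1)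
    tail = ℤ-Ring.solve-∀

  start-decode : ∀ {J w} → J < n → ShiftsTo J 0ℤ w → evenCycle (+ 2 ℤ.* + w) ≡ J
  start-decode {J} {w} J<n tail =
    %ℕ-unique n (ℤ.- (+ 2 ℤ.* + w)) J<n (∣-combine (+ 2) 0ℤ (ℤ.- + J) (cycle H (+ J) (+ w)) tail ∣0)
    where
    cycle : ∀ H J w → ℤ.- (+ 2 ℤ.* w) ℤ.- J ≡ + 2 ℤ.* (0ℤ ℤ.+ J ℤ.* H ℤ.- w) ℤ.+ 0ℤ ℤ.* 0ℤ ℤ.+ ℤ.- J ℤ.* (+ 2 ℤ.* H ℤ.+ + 1)
    cycle = ℤ-Ring.solve-∀

  end-decode : ∀ {J w} → J < n → ShiftsTo J H w → oddCycle (+ 2 ℤ.* + w) ≡ J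
  end-decode {J} {w} J<n head =
    %ℕ-unique n (ℤ.- (+ 2 ℤ.* + w) ℤ.- + 1) J<n (∣-combine (+ 2) 0ℤ (ℤ.- (+ J ℤ.+ + 1)) (cycle H (+ J) (+ w)) head ∣0)
    where
    cycle : ∀ H J w → ℤ.- (+ 2 ℤ.* w) ℤ.- + 1 ℤ.- J ≡ + 2 ℤ.* (H ℤ.+ J ℤ.* H ℤ.- w) ℤ.+ 0ℤ ℤ.* 0ℤ ℤ.+ ℤ.- (J ℤ.+ + 1) ℤ.* (+ 2 ℤ.* H ℤ.+ + 1)
    cycle = ℤ-Ring.solve-∀

  start-encode : ∀ w → ShiftsTo (evenCycle (+ 2 ℤ.* + w)) 0ℤ w
  start-encode w = ∣-half (∣-combine (+ 1) 0ℤ J (tail H J (+ w)) (%ℕ-∣ n (ℤ.- (+ 2 ℤ.* + w))) ∣0)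
    where
    J = + evenCycle (+ 2 ℤ.* + w)
    tail : ∀ H J w → + 2 ℤ.* (0ℤ ℤ.+ J ℤ.* H ℤ.- w) ≡ + 1 ℤ.* (ℤ.- (+ 2 ℤ.* w) ℤ.- J) ℤ.+ 0ℤ ℤ.* 0ℤ ℤ.+ J ℤ.* (+ 2 ℤ.* H ℤ.+ + 1)
    tail = ℤ-Ring.solve-∀

  end-encode : ∀ w → ShiftsTo (oddCycle (+ 2 ℤ.* + w)) H w
  end-encode w = ∣-half (∣-combine (+ 1) 0ℤ (J ℤ.+ + 1) (head H J (+ w)) (%ℕ-∣ n (ℤ.- (+ 2 ℤ.* + w) ℤ.- + 1)) ∣0)
    where
    J = + oddCycle (+ 2 ℤ.* + w)
    head : ∀ H J w → + 2 ℤ.* (H ℤ.+ J ℤ.* H ℤ.- w) ≡ + 1 ℤ.* (ℤ.- (+ 2 ℤ.* w) ℤ.- + 1 ℤ.- J) ℤ.+ 0ℤ ℤ.* 0ℤ ℤ.+ (J ℤ.+ + 1) ℤ.* (+ 2 ℤ.* H ℤ.+ + 1)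
    head = ℤ-Ring.solve-∀

  n∸even : ∀ {q} → q < h → n ∸ (2 + 2 * q) ≡ 1 + 2 * mirror q
  n∸even {q} q<h = trans (cong (_∸ (2 + 2 * q)) n≡) (ℕ.m+n∸m≡n (2 + 2 * q) (1 + 2 * mirror q))
    where
    split : ∀ q r → 1 + 2 * (suc q + r) ≡ 2 + 2 * q + (1 + 2 * r)
    split = ℕ-Ring.solve-∀
    n≡ : n ≡ 2 + 2 * q + (1 + 2 * mirror q)
    n≡ = trans n≡1+2h (trans (cong (λ t → 1 + 2 * t) (h≡1+q+mirror q<h)) (split q (mirror q)))

  n∸odd : ∀ {q} → q < h → n ∸ (1 + 2 * q) ≡ 2 + 2 * mirror q
  n∸odd {q} q<h = trans (cong (_∸ (1 + 2 * q)) n≡) (ℕ.m+n∸m≡n (1 + 2 * q) (2 + 2 * mirror q))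
    where
    split : ∀ q r → 1 + 2 * (suc q + r) ≡ 1 + 2 * q + (2 + 2 * r)
    split = ℕ-Ring.solve-∀
    n≡ : n ≡ 1 + 2 * q + (2 + 2 * mirror q)
    n≡ = trans n≡1+2h (trans (cong (λ t → 1 + 2 * t) (h≡1+q+mirror q<h)) (split q (mirror q)))

  mirror-involutive : ∀ {q} → q < h → mirror (mirror q) ≡ q
  mirror-involutive {q} q<h = trans (cong (_∸ suc (mirror q)) h≡) (ℕ.m+n∸m≡n (suc (mirror q)) q)
    where
    h≡ : h ≡ suc (mirror q) + q
    h≡ = trans (h≡1+q+mirror q<h) (cong suc (ℕ.+-comm q (mirror q)))

  EvenGap : ℕ → ℕ → Set
  EvenGap u v = Σ ℕ λ q → gap u v ≡ 2 + 2 * q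

  gap≡0⇒≡ : ∀ {u v} → u < n → v < n → gap u v ≡ 0 → v ≡ u
  gap≡0⇒≡ {u} {v} u<n v<n g≡0 = ∣-<⇒≡ v<n u<n
    (subst (λ t → + n ∣ t) (ℤ.+-identityʳ (+ v ℤ.- + u)) (subst (λ g → + n ∣ + v ℤ.- + u ℤ.- + g) g≡0 (%ℕ-∣ n (+ v ℤ.- + u))))

  gap-flip : ∀ {u v} → u < n → v < n → u ≢ v → gap v u ≡ n ∸ gap u v
  gap-flip {u} {v} u<n v<n u≢v = %ℕ-unique n (+ u ℤ.- + v) (ℕ.∸-monoʳ-< 0<g g≤n)
    (∣-linear (ℤ.- + 1) 0ℤ (ℤ.- + 1) (trans (cong (λ t → + u ℤ.- + v ℤ.- t) +n∸g) (flipped (+ u) (+ v) (+ g) (+ n)))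
      (%ℕ-∣ n (+ v ℤ.- + u)) ∣0)
    where
    g = gap u v
    g≤n : g ≤ n
    g≤n = ℕ.<⇒≤ (n%ℕd<d (+ v ℤ.- + u) n)
    0<g : 0 < g
    0<g = ℕ.n≢0⇒n>0 (λ g≡0 → u≢v (sym (gap≡0⇒≡ u<n v<n g≡0)))
    +n∸g : + (n ∸ g) ≡ + n ℤ.- + g
    +n∸g = sym (trans (ℤ.m-n≡m⊖n n g) (ℤ.⊖-≥ g≤n))
    flipped : ∀ u v g n → u ℤ.- v ℤ.- (n ℤ.- g) ≡ ℤ.- + 1 ℤ.* (v ℤ.- u ℤ.- g) ℤ.+ 0ℤ ℤ.* 0ℤ ℤ.+ ℤ.- + 1 ℤ.* n
    flipped = ℤ-Ring.solve-∀

  evenGap-asym : ∀ {u v} → u < n → v < n → u ≢ v → EvenGap u v → ¬ EvenGap v u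
  evenGap-asym {u} {v} u<n v<n u≢v (q , g≡) (q′ , g′≡) = ℕ.even≢odd (suc q′) (mirror q) (begin
    2 * suc q′                ≡⟨ two-suc q′ ⟩
    2 + 2 * q′                ≡⟨ sym g′≡ ⟩
    gap v u                   ≡⟨ gap-flip u<n v<n u≢v ⟩
    n ∸ gap u v               ≡⟨ cong (n ∸_) g≡ ⟩
    n ∸ (2 + 2 * q)           ≡⟨ n∸even {q} q<h ⟩
    1 + 2 * mirror q          ∎)
    where
    open ≡-Reasoning
    q<h : q < h
    q<h = 2+2q<n⁻¹ {q} (subst (_< n) g≡ (n%ℕd<d (+ v ℤ.- + u) n))

  evenGap-either : ∀ {u v} → u < n → v < n → u ≢ v → EvenGap u v ⊎ EvenGap v u
  evenGap-either {u} {v} u<n v<n u≢v with even⊎odd (gap u v)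
  ... | inj₁ (zero , g≡0)  = contradiction (sym (gap≡0⇒≡ u<n v<n g≡0)) u≢v
  ... | inj₁ (suc q , g≡)  = inj₁ (q , trans g≡ (two-suc q))
  ... | inj₂ (e , g≡)      = inj₂ (mirror e , (begin
    gap v u          ≡⟨ gap-flip u<n v<n u≢v ⟩
    n ∸ gap u v      ≡⟨ cong (n ∸_) g≡ ⟩
    n ∸ (1 + 2 * e)  ≡⟨ n∸odd {e} e<h ⟩
    2 + 2 * mirror e ∎))
    where
    open ≡-Reasoning
    e<h : e < h
    e<h = 1+2q<n⁻¹ {e} (subst (_< n) g≡ (n%ℕd<d (+ v ℤ.- + u) n))

  Adjacent : ℕ → ℕ → Set
  Adjacent J₁ J₂ = (J₁ ≡ 0 × J₂ ≡ lastIndex) ⊎ J₁ ≡ suc J₂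

  cycles-adjacent : ∀ s → Adjacent (evenCycle s) (oddCycle s)
  cycles-adjacent s = %ℕ-pred lastIndex (ℤ.- s)

  -- The matrices T_J

  data Kind : Set where
    zeroth final odd even : Kind

  kind : ℕ → Kind
  kind J with J ≟ 0 | J ≟ lastIndex | parity J
  ... | yes _ | _     | _  = zeroth
  ... | no _  | yes _ | _  = final
  ... | no _  | no _  | 0ℙ = even
  ... | no _  | no _  | 1ℙ = odd

  -- The two patches lie on one edge: position 2 of T₀ and position n - 2 of T_{x-2}.
  special : Kind → ℕ → Triple
  special zeroth = periodic [ 2 ≔ (# 2 , # 1 , # 0) ]
  special final  = periodic [ 1 + 2 * mirror 0 ≔ (# 5 , # 4 , # 3) ]
  special odd    = periodic
  special even   = periodic

  column₀ : Kind → Triple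
  column₀ zeroth = # 0 , # 1 , # 2
  column₀ final  = # 0 , # 2 , # 4
  column₀ odd    = # 1 , # 3 , # 5
  column₀ even   = # 0 , # 2 , # 4

  columnₙ : Kind → Triple
  columnₙ zeroth = # 0 , # 4 , # 2
  columnₙ final  = # 2 , # 3 , # 1
  columnₙ odd    = # 5 , # 3 , # 1
  columnₙ even   = # 0 , # 4 , # 2

  columns : Kind → ℕ → Triple
  columns K = special K [ n ≔ columnₙ K ] [ 0 ≔ column₀ K ]

  T : Matrices x
  T j r i = entry (columns (kind (toℕ j)) (toℕ i)) r

  kind-zeroth⁻¹ : ∀ J → kind J ≡ zeroth → J ≡ 0
  kind-zeroth⁻¹ J eq with J ≟ 0 | J ≟ lastIndex | parity J
  kind-zeroth⁻¹ J eq  | yes J≡0 | _ | _  = J≡0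
  kind-zeroth⁻¹ J ()  | no _    | yes _ | _
  kind-zeroth⁻¹ J ()  | no _    | no _  | 0ℙ
  kind-zeroth⁻¹ J ()  | no _    | no _  | 1ℙ

  kind-final⁻¹ : ∀ J → kind J ≡ final → J ≡ lastIndex
  kind-final⁻¹ J eq with J ≟ 0 | J ≟ lastIndex | parity J
  kind-final⁻¹ J ()  | yes _ | _       | _
  kind-final⁻¹ J eq  | no _  | yes J≡ℓ | _  = J≡ℓ
  kind-final⁻¹ J ()  | no _  | no _    | 0ℙ
  kind-final⁻¹ J ()  | no _  | no _    | 1ℙ

  kind-lastIndex : kind lastIndex ≡ final
  kind-lastIndex with lastIndex ≟ lastIndex
  ... | yes _ = refl
  ... | no ℓ≢ℓ = contradiction refl ℓ≢ℓ

  kind-odd : ∀ e → kind (1 + 2 * e) ≡ odd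
  kind-odd e with 1 + 2 * e ≟ lastIndex | parity (1 + 2 * e) | parity-odd e
  ... | yes odd≡ℓ | _   | _    = contradiction (sym (trans odd≡ℓ lastIndex≡2h)) (ℕ.even≢odd h e)
  ... | no _      | .1ℙ | refl = refl

  column₀-even : ∀ e → column₀ (kind (2 * suc e)) ≡ (# 0 , # 2 , # 4)
  column₀-even e with 2 * suc e ≟ 0 | 2 * suc e ≟ lastIndex | parity (2 * suc e) | parity-even (suc e)
  ... | yes ()  | _     | _   | _
  ... | no _    | yes _ | _   | _    = refl
  ... | no _    | no _  | .0ℙ | refl = refl

  columnₙ-even : ∀ e → 2 * e ≢ lastIndex → columnₙ (kind (2 * e)) ≡ (# 0 , # 4 , # 2)
  columnₙ-even e 2e≢ℓ with 2 * e ≟ 0 | 2 * e ≟ lastIndex | parity (2 * e) | parity-even e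
  ... | yes _  | _       | _   | _    = refl
  ... | no _   | yes 2e≡ℓ | _  | _    = contradiction 2e≡ℓ 2e≢ℓ
  ... | no _   | no _    | .0ℙ | refl = refl

  columns-middle : ∀ K {k} → k ≢ 0 → k ≢ n → columns K k ≡ special K k
  columns-middle K {k} k≢0 k≢n =
    trans (update-other (special K [ n ≔ columnₙ K ]) 0 (column₀ K) {k} k≢0) (update-other (special K) n (columnₙ K) k≢n)

  columns-n : ∀ K → columns K n ≡ columnₙ K
  columns-n K = trans (update-other (special K [ n ≔ columnₙ K ]) 0 (column₀ K) {n} (λ ())) (update-same (special K) n (columnₙ K))

  even-column : ∀ J {q} → q < h → ¬ (J ≡ 0 × q ≡ 0) → EvenTriple (columns (kind J) (2 + 2 * q))
  even-column J {q} q<h not-special =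
    subst EvenTriple (sym (columns-middle (kind J) (λ ()) (λ eq → 2+2q≢1+2r q h (trans eq n≡1+2h)))) (middle (kind J) refl)
    where
    in-periodic : EvenTriple (periodic (2 + 2 * q))
    in-periodic = subst (EvenTriple ∘ periodic) (two-suc q) (periodic-even (suc q))
    middle : ∀ K → kind J ≡ K → EvenTriple (special K (2 + 2 * q))
    middle zeroth eq = subst EvenTriple (sym (update-other periodic 2 _ (λ e → not-special (kind-zeroth⁻¹ J eq , q≡0 e)))) in-periodic
      where
      q≡0 : 2 + 2 * q ≡ 2 → q ≡ 0
      q≡0 e = ℕ.*-cancelˡ-≡ q 0 2 (ℕ.+-cancelˡ-≡ 2 (2 * q) 0 e)
    middle final _ = subst EvenTriple (sym (update-other periodic _ _ (2+2q≢1+2r q (mirror 0)))) in-periodic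
    middle odd   _ = in-periodic
    middle even  _ = in-periodic

  odd-column : ∀ J {q} → q < h → ¬ (J ≡ lastIndex × q ≡ mirror 0) → OddTriple (columns (kind J) (1 + 2 * q))
  odd-column J {q} q<h not-special =
    subst OddTriple (sym (columns-middle (kind J) (λ ()) (ℕ.<⇒≢ (1+2q<n q<h)))) (middle (kind J) refl)
    where
    middle : ∀ K → kind J ≡ K → OddTriple (special K (1 + 2 * q))
    middle zeroth _  = subst OddTriple (sym (update-other periodic 2 _ (2+2q≢1+2r 0 q ∘ sym))) (periodic-odd q)
    middle final  eq = subst OddTriple (sym (update-other periodic _ _ (λ e → not-special (kind-final⁻¹ J eq , q≡ e)))) (periodic-odd q)
      where
      q≡ : 1 + 2 * q ≡ 1 + 2 * mirror 0 → q ≡ mirror 0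
      q≡ e = ℕ.*-cancelˡ-≡ q (mirror 0) 2 (ℕ.suc-injective e)
    middle odd    _  = periodic-odd q
    middle even   _  = periodic-odd q

  columns-A₂ : columns (kind 0) 2 ≡ (# 2 , # 1 , # 0)
  columns-A₂ = refl

  columns-B₂ : columns (kind lastIndex) (1 + 2 * mirror 0) ≡ (# 5 , # 4 , # 3)
  columns-B₂ = trans (cong (λ K → columns K (1 + 2 * mirror 0)) kind-lastIndex)
                     (trans (columns-middle final (λ ()) (ℕ.<⇒≢ (1+2q<n (mirror<h 0)))) (update-same periodic (1 + 2 * mirror 0) (# 5 , # 4 , # 3)))

  FiniteComplementary : ℕ → ℕ → ℕ → Set
  FiniteComplementary J₁ J₂ q = entries (columns (kind J₁) (2 + 2 * q)) ++ entries (columns (kind J₂) (1 + 2 * mirror q)) ↭ allFin 6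

  private
    complementary-cases : ∀ {J₁ J₂ q} → Dec (J₁ ≡ 0) → Dec (q ≡ 0) → J₁ < n → Adjacent J₁ J₂ → q < h → FiniteComplementary J₁ J₂ q
    complementary-cases (yes refl) (yes refl) _ (inj₁ (_ , refl)) _ =
      subst₂ (λ a b → entries a ++ entries b ↭ allFin 6) (sym columns-A₂) (sym columns-B₂) (↭-by-sorting refl)
    complementary-cases (yes refl) (yes refl) _ (inj₂ ()) _
    complementary-cases {J₂ = J₂} {q} (yes refl) (no q≢0) _ _ q<h =
      even-odd-complementary (even-column 0 q<h (q≢0 ∘ proj₂)) (odd-column J₂ (mirror<h q) not-special)
      where
      not-special : ¬ (J₂ ≡ lastIndex × mirror q ≡ mirror 0)
      not-special (_ , eq) = q≢0 (trans (sym (mirror-involutive q<h)) (trans (cong mirror eq) (mirror-involutive (s≤s z≤n))))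
    complementary-cases {J₁} {J₂} {q} (no J₁≢0) _ J₁<n adjacent q<h =
      even-odd-complementary (even-column J₁ q<h (J₁≢0 ∘ proj₁)) (odd-column J₂ (mirror<h q) not-special)
      where
      not-special : ¬ (J₂ ≡ lastIndex × mirror q ≡ mirror 0)
      not-special (J₂≡ℓ , _) = [ J₁≢0 ∘ proj₁ , (λ J₁≡1+J₂ → ℕ.<-irrefl (trans J₁≡1+J₂ (cong suc J₂≡ℓ)) J₁<n) ]′ adjacent

  finite-complementary : ∀ {J₁ J₂ q} → J₁ < n → Adjacent J₁ J₂ → q < h → FiniteComplementary J₁ J₂ q
  finite-complementary {J₁} {q = q} = complementary-cases (J₁ ≟ 0) (q ≟ 0)

  InfinityComplementary : ℕ → ℕ → Set
  InfinityComplementary J₁ J₂ = entries (columns (kind J₁) 0) ++ map neg6 (entries (columns (kind J₂) n)) ↭ allFin 6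

  private
    infinity-via : ∀ {J₁ J₂ a b} → column₀ (kind J₁) ≡ a → columnₙ (kind J₂) ≡ b →
                   entries a ++ map neg6 (entries b) ↭ allFin 6 → InfinityComplementary J₁ J₂
    infinity-via {J₁} {J₂} refl refl complementary =
      subst (λ t → entries (column₀ (kind J₁)) ++ map neg6 (entries t) ↭ allFin 6) (sym (columns-n (kind J₂))) complementary

  infinity-complementary : ∀ {J₁ J₂} → J₁ < n → Adjacent J₁ J₂ → InfinityComplementary J₁ J₂
  infinity-complementary _ (inj₁ (refl , refl)) = infinity-via {0} refl (cong columnₙ kind-lastIndex) (↭-by-sorting refl)
  infinity-complementary {J₂ = J₂} J₁<n (inj₂ refl) with even⊎odd J₂
  ... | inj₁ (e , refl) = infinity-via (cong column₀ (kind-odd e)) (columnₙ-even e (ℕ.<⇒≢ (ℕ.≤-pred J₁<n))) (↭-by-sorting refl)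
  ... | inj₂ (e , refl) = infinity-via (trans (cong (column₀ ∘ kind) (sym (two-suc e))) (column₀-even e))
                                       (cong columnₙ (kind-odd e)) (↭-by-sorting refl)

  columns-distinct : ∀ K k → Distinct (columns K k)
  columns-distinct K = update-preserves (special K [ n ≔ columnₙ K ]) 0 (column₀ K) {Distinct} (column₀-distinct K)
                         (update-preserves (special K) n (columnₙ K) {Distinct} (columnₙ-distinct K) (special-distinct K))
    where
    column₀-distinct : ∀ K → Distinct (column₀ K)
    column₀-distinct zeroth = distinct (λ ()) (λ ()) (λ ())
    column₀-distinct final  = distinct (λ ()) (λ ()) (λ ())
    column₀-distinct odd    = distinct (λ ()) (λ ()) (λ ())
    column₀-distinct even   = distinct (λ ()) (λ ()) (λ ())
    columnₙ-distinct : ∀ K → Distinct (columnₙ K)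
    columnₙ-distinct zeroth = distinct (λ ()) (λ ()) (λ ())
    columnₙ-distinct final  = distinct (λ ()) (λ ()) (λ ())
    columnₙ-distinct odd    = distinct (λ ()) (λ ()) (λ ())
    columnₙ-distinct even   = distinct (λ ()) (λ ()) (λ ())
    special-distinct : ∀ K k → Distinct (special K k)
    special-distinct zeroth = update-preserves periodic 2 (# 2 , # 1 , # 0) {Distinct} (distinct (λ ()) (λ ()) (λ ())) periodic-distinct
    special-distinct final  = update-preserves periodic _ (# 5 , # 4 , # 3) {Distinct} (distinct (λ ()) (λ ()) (λ ())) periodic-distinct
    special-distinct odd    = periodic-distinct
    special-distinct even   = periodic-distinct

  -- Row sums

  displaced inserted : Kind → Fin 3 → ℕ
  displaced zeroth r = rowOf r (periodic 2)
  displaced final  r = rowOf r (periodic 1)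
  displaced odd    _ = 0
  displaced even   _ = 0
  inserted zeroth r = rowOf r (# 2 , # 1 , # 0)
  inserted final  r = rowOf r (# 5 , # 4 , # 3)
  inserted odd    _ = 0
  inserted even   _ = 0

  special-0 : ∀ K → special K 0 ≡ periodic 0
  special-0 zeroth = refl
  special-0 final  = refl
  special-0 odd    = refl
  special-0 even   = refl

  special-n : ∀ K → special K n ≡ periodic 3
  special-n zeroth = periodic-period 3 m
  special-n final  = trans (update-other periodic (1 + 2 * mirror 0) _ {n} (ℕ.<⇒≢ (1+2q<n (mirror<h 0)) ∘ sym)) (periodic-period 3 m)
  special-n odd    = periodic-period 3 m
  special-n even   = periodic-period 3 m

  Σ-special : ∀ K r → Σ< x (rowOf r ∘ special K) + displaced K r ≡ Σ< x (rowOf r ∘ periodic) + inserted K r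
  Σ-special zeroth r = Σ<-update periodic 2 _ x (rowOf r) (s≤s (s≤s (s≤s z≤n)))
  Σ-special final  r = subst (λ t → Σ< x (rowOf r ∘ special final) + rowOf r t ≡ Σ< x (rowOf r ∘ periodic) + inserted final r)
                             (trans (cong periodic (four-m m)) (periodic-period 1 m))
                             (Σ<-update periodic (1 + 2 * mirror 0) _ x (rowOf r) (ℕ.<-trans (1+2q<n (mirror<h 0)) (ℕ.n<1+n n)))
    where
    four-m : ∀ m → 1 + 2 * (2 * m) ≡ 1 + 4 * m
    four-m = ℕ-Ring.solve-∀
  Σ-special odd    r = refl
  Σ-special even   r = refl

  Σ-columns : ∀ K r → Σ< x (rowOf r ∘ columns K) + (rowOf r (periodic 0) + rowOf r (periodic 3) + displaced K r)
                     ≡ suc m * weight r * 6 + (rowOf r (column₀ K) + rowOf r (columnₙ K) + inserted K r)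
  Σ-columns K r = +-telescope {S₀} {S₂} {suc m * weight r * 6} (+-telescope {S₀} {S₁} {S₂} update₀ updateₙ)
                                      (trans (Σ-special K r) (cong (_+ inserted K r) (Σ-periodic m r)))
    where
    S₀ S₁ S₂ : ℕ
    S₀ = Σ< x (rowOf r ∘ columns K)
    S₁ = Σ< x (rowOf r ∘ (special K [ n ≔ columnₙ K ]))
    S₂ = Σ< x (rowOf r ∘ special K)
    update₀ : S₀ + rowOf r (periodic 0) ≡ S₁ + rowOf r (column₀ K)
    update₀ = subst (λ t → S₀ + rowOf r t ≡ S₁ + rowOf r (column₀ K)) (special-0 K)
                (Σ<-update (special K [ n ≔ columnₙ K ]) 0 (column₀ K) x (rowOf r) (s≤s z≤n))
    updateₙ : S₁ + rowOf r (periodic 3) ≡ S₂ + rowOf r (columnₙ K)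
    updateₙ = subst (λ t → S₁ + rowOf r t ≡ S₂ + rowOf r (columnₙ K)) (special-n K)
                (Σ<-update (special K) n (columnₙ K) x (rowOf r) (ℕ.n<1+n n))

  rowResidue : Kind → Fin 3 → ℕ
  rowResidue K r = (rowOf r (column₀ K) + rowOf r (columnₙ K) + inserted K r
                    + 5 * (rowOf r (periodic 0) + rowOf r (periodic 3) + displaced K r)) % 6

  rowSum≡rowResidue : ∀ j r → rowSum x T j r ≡ rowResidue (kind (toℕ j)) r
  rowSum≡rowResidue j r = trans (cong (_% 6) (sum-allFin x (rowOf r ∘ columns K)))
                                (%-shift 5 {Σ< x (rowOf r ∘ columns K)} {K = suc m * weight r} (Σ-columns K r))
    where
    K = kind (toℕ j)

  rowSum-ordinary : ∀ j → toℕ j < lastIndex → ∀ r → rowSum x T j r ≡ 3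
  rowSum-ordinary j j<ℓ r = trans (rowSum≡rowResidue j r) (ordinary (kind (toℕ j)) refl r)
    where
    ordinary : ∀ K → kind (toℕ j) ≡ K → ∀ r → rowResidue K r ≡ 3
    ordinary zeroth _ zero             = refl
    ordinary zeroth _ (suc zero)       = refl
    ordinary zeroth _ (suc (suc zero)) = refl
    ordinary odd    _ zero             = refl
    ordinary odd    _ (suc zero)       = refl
    ordinary odd    _ (suc (suc zero)) = refl
    ordinary even   _ zero             = refl
    ordinary even   _ (suc zero)       = refl
    ordinary even   _ (suc (suc zero)) = refl
    ordinary final  eq _ = contradiction (kind-final⁻¹ (toℕ j) eq) (ℕ.<⇒≢ j<ℓ)

  rowSum-last : ∀ j → toℕ j ≡ lastIndex → rowSum x T j (# 2) ≡ 0 × (∀ r → r ≢ # 2 → rowSum x T j r ≡ 3)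
  rowSum-last j j≡ℓ = by-rowResidue (# 2) , λ r r≢2 → trans (by-rowResidue r) (others r r≢2)
    where
    final-kind : kind (toℕ j) ≡ final
    final-kind = trans (cong kind j≡ℓ) kind-lastIndex
    by-rowResidue : ∀ r → rowSum x T j r ≡ rowResidue final r
    by-rowResidue r = trans (rowSum≡rowResidue j r) (cong (λ K → rowResidue K r) final-kind)
    others : ∀ r → r ≢ # 2 → rowResidue final r ≡ 3
    others zero             _   = refl
    others (suc zero)       _   = refl
    others (suc (suc zero)) r≢2 = contradiction refl r≢2

  -- Covering the edges

  open Incidence T

  private
    ShiftsTo⇒shift′ : ∀ {J J′} a {a′ u} → J ≡ J′ → + a ≡ a′ → u < n → ShiftsTo J′ a′ u → shift J a ≡ u
    ShiftsTo⇒shift′ {J} a refl refl u<n = ShiftsTo⇒shift {J} {a} u<n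

    end⇒ShiftsTo : ∀ {p} J a {a′ u} → + a ≡ a′ → p ≡ just (shift J a) → p ≡ just u → ShiftsTo J a′ u
    end⇒ShiftsTo J a refl end₁ end₂ = shift⇒ShiftsTo {J} {a} (just-injective (trans (sym end₁) end₂))

    <n⇒<x : ∀ {k} → k < n → k < x
    <n⇒<x k<n = ℕ.<-trans k<n (ℕ.n<1+n n)

  column-at : ∀ {J k} → J < n → k < x → Column
  column-at J<n k<x = fromℕ< J<n , fromℕ< k<x

  column-at-unique : ∀ {j i J k} (J<n : J < n) (k<x : k < x) → toℕ j ≡ J → toℕ i ≡ k → (j , i) ≡ column-at J<n k<x
  column-at-unique J<n k<x j≡ i≡ = cong₂ _,_ (Fin.toℕ-injective (trans j≡ (sym (Fin.toℕ-fromℕ< J<n))))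
                                             (Fin.toℕ-injective (trans i≡ (sym (Fin.toℕ-fromℕ< k<x))))

  entriesAt-column-at : ∀ {J k} (J<n : J < n) (k<x : k < x) → entriesAt (column-at J<n k<x) ≡ entries (columns (kind J) k)
  entriesAt-column-at J<n k<x = cong₂ (λ J k → entries (columns (kind J) k)) (Fin.toℕ-fromℕ< J<n) (Fin.toℕ-fromℕ< k<x)

  module _ {u v q} (u<n : u < n) (v<n : v < n) (q<h : q < h) (g≡ : gap u v ≡ 2 + 2 * q) where

    evenCycle<n : evenCycle (+ u ℤ.+ + v) < n
    evenCycle<n = n%ℕd<d (ℤ.- (+ u ℤ.+ + v)) n

    oddCycle<n : oddCycle (+ u ℤ.+ + v) < n
    oddCycle<n = n%ℕd<d (ℤ.- (+ u ℤ.+ + v) ℤ.- + 1) n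

    evenColumn oddColumn : Column
    evenColumn = column-at evenCycle<n (<n⇒<x (2+2q<n q<h))
    oddColumn  = column-at oddCycle<n (<n⇒<x (1+2q<n (mirror<h q)))

    evenColumn-entries : entriesAt evenColumn ≡ entries (columns (kind (evenCycle (+ u ℤ.+ + v))) (2 + 2 * q))
    evenColumn-entries = entriesAt-column-at evenCycle<n (<n⇒<x (2+2q<n q<h))

    oddColumn-entries : entriesAt oddColumn ≡ entries (columns (kind (oddCycle (+ u ℤ.+ + v))) (1 + 2 * mirror q))
    oddColumn-entries = entriesAt-column-at oddCycle<n (<n⇒<x (1+2q<n (mirror<h q)))

    evenColumn-joins : Joins evenColumn (just u) (just v)
    evenColumn-joins =
      trans (proj₁ ends) (cong just (ShiftsTo⇒shift′ _ (Fin.toℕ-fromℕ< evenCycle<n) (+far q<h) u<n (proj₁ encoded))) ,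
      trans (proj₂ ends) (cong just (ShiftsTo⇒shift′ (1 + q) (Fin.toℕ-fromℕ< evenCycle<n) (ℤ.pos-+ 1 q) v<n (proj₂ encoded)))
      where
      ends = even-ends (proj₁ evenColumn) (proj₂ evenColumn) q<h (Fin.toℕ-fromℕ< (<n⇒<x (2+2q<n q<h)))
      encoded = even-encode u v g≡

    oddColumn-joins : Joins oddColumn (just u) (just v)
    oddColumn-joins =
      trans (proj₁ ends) (cong just (ShiftsTo⇒shift′ (mirror q) (Fin.toℕ-fromℕ< oddCycle<n) refl u<n (proj₁ encoded))) ,
      trans (proj₂ ends) (cong just (ShiftsTo⇒shift′ _ (Fin.toℕ-fromℕ< oddCycle<n) (+far (mirror<h q)) v<n (proj₂ encoded)))
      where
      ends = odd-ends (proj₁ oddColumn) (proj₂ oddColumn) (mirror<h q) (Fin.toℕ-fromℕ< (<n⇒<x (1+2q<n (mirror<h q))))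
      encoded = odd-encode u v q<h g≡

  finite-joins⇒column : ∀ {u v} (j : Fin n) (i : Fin x) → Joins (j , i) (just u) (just v) →
    Σ ℕ λ q → gap u v ≡ 2 + 2 * q × ((toℕ j ≡ evenCycle (+ u ℤ.+ + v) × toℕ i ≡ 2 + 2 * q)
                                    ⊎ (toℕ j ≡ oddCycle (+ u ℤ.+ + v) × toℕ i ≡ 1 + 2 * mirror q))
  finite-joins⇒column j i (hu , hv) with position (Fin.toℕ<n i)
  ... | start i≡0 = contradiction (trans (sym hu) (proj₁ (start-ends j i i≡0))) λ ()
  ... | end   i≡n = contradiction (trans (sym hv) (proj₂ (end-ends j i i≡n))) λ ()
  ... | evenPos q q<h i≡ = q , proj₂ decoded , inj₁ (sym (proj₁ decoded) , i≡)
    where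
    ends = even-ends j i q<h i≡
    decoded = even-decode (Fin.toℕ<n j) q<h (end⇒ShiftsTo (toℕ j) _ (+far q<h) (proj₁ ends) hu)
                                            (end⇒ShiftsTo (toℕ j) (1 + q) (ℤ.pos-+ 1 q) (proj₂ ends) hv)
  ... | oddPos q q<h i≡ = mirror q , proj₂ decoded , inj₂ (sym (proj₁ decoded) , trans i≡ (cong (λ t → 1 + 2 * t) (sym (mirror-involutive q<h))))
    where
    ends = odd-ends j i q<h i≡
    decoded = odd-decode (Fin.toℕ<n j) q<h (end⇒ShiftsTo (toℕ j) q refl (proj₁ ends) hu)
                                           (end⇒ShiftsTo (toℕ j) _ (+far q<h) (proj₂ ends) hv)

  finite-cover : ∀ {u v} → u < n → v < n → u ≢ v → EvenGap u v → Cover (just u) (just v)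
  finite-cover {u} {v} u<n v<n u≢v (q , g≡) = record
    { c₁ = c₁ ; c₂ = c₂ ; c₁≢c₂ = c₁≢c₂
    ; covers₁ = inj₁ (evenColumn-joins u<n v<n q<h g≡) ; covers₂ = inj₁ (oddColumn-joins u<n v<n q<h g≡)
    ; only = only
    ; complementary = subst₂ (λ a b → a ++ b ↭ allFin 6)
        (sym (trans (proj₂ (forward c₁ (evenColumn-joins u<n v<n q<h g≡))) (evenColumn-entries u<n v<n q<h g≡)))
        (sym (trans (proj₂ (forward c₂ (oddColumn-joins u<n v<n q<h g≡))) (oddColumn-entries u<n v<n q<h g≡)))
        (finite-complementary (evenCycle<n u<n v<n q<h g≡) (cycles-adjacent (+ u ℤ.+ + v)) q<h)
    }
    where
    q<h : q < h
    q<h = 2+2q<n⁻¹ {q} (subst (_< n) g≡ (n%ℕd<d (+ v ℤ.- + u) n))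
    c₁ c₂ : Column
    c₁ = evenColumn u<n v<n q<h g≡
    c₂ = oddColumn u<n v<n q<h g≡
    c₁≢c₂ : c₁ ≢ c₂
    c₁≢c₂ c₁≡c₂ = 2+2q≢1+2r q (mirror q)
      (trans (sym (Fin.toℕ-fromℕ< (<n⇒<x (2+2q<n q<h))))
             (trans (cong (toℕ ∘ proj₂) c₁≡c₂) (Fin.toℕ-fromℕ< (<n⇒<x (1+2q<n (mirror<h q))))))
    same-q : ∀ q′ → gap u v ≡ 2 + 2 * q′ → q′ ≡ q
    same-q q′ g′≡ = ℕ.*-cancelˡ-≡ q′ q 2 (ℕ.+-cancelˡ-≡ 2 (2 * q′) (2 * q) (trans (sym g′≡) g≡))
    only : ∀ c → Covers (just u) (just v) c → c ≡ c₁ ⊎ c ≡ c₂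
    only (j , i) (inj₁ joins) with finite-joins⇒column j i joins
    ... | q′ , g′≡ , inj₁ (j≡ , i≡) =
      inj₁ (column-at-unique (evenCycle<n u<n v<n q<h g≡) (<n⇒<x (2+2q<n q<h)) j≡ (trans i≡ (cong (λ t → 2 + 2 * t) (same-q q′ g′≡))))
    ... | q′ , g′≡ , inj₂ (j≡ , i≡) =
      inj₂ (column-at-unique (oddCycle<n u<n v<n q<h g≡) (<n⇒<x (1+2q<n (mirror<h q))) j≡ (trans i≡ (cong (λ t → 1 + 2 * mirror t) (same-q q′ g′≡))))
    only (j , i) (inj₂ joins) with finite-joins⇒column j i joins
    ... | q′ , g′≡ , _ = contradiction (q′ , g′≡) (evenGap-asym u<n v<n u≢v (q , g≡))

  module _ {w} (w<n : w < n) where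

    startCycle<n : evenCycle (+ 2 ℤ.* + w) < n
    startCycle<n = n%ℕd<d (ℤ.- (+ 2 ℤ.* + w)) n

    endCycle<n : oddCycle (+ 2 ℤ.* + w) < n
    endCycle<n = n%ℕd<d (ℤ.- (+ 2 ℤ.* + w) ℤ.- + 1) n

    startColumn endColumn : Column
    startColumn = column-at startCycle<n (s≤s z≤n)
    endColumn   = column-at endCycle<n (ℕ.n<1+n n)

    startColumn-entries : entriesAt startColumn ≡ entries (columns (kind (evenCycle (+ 2 ℤ.* + w))) 0)
    startColumn-entries = entriesAt-column-at startCycle<n (s≤s z≤n)

    endColumn-entries : entriesAt endColumn ≡ entries (columns (kind (oddCycle (+ 2 ℤ.* + w))) n)
    endColumn-entries = entriesAt-column-at endCycle<n (ℕ.n<1+n n)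

    startColumn-joins : Joins startColumn nothing (just w)
    startColumn-joins = proj₁ ends , trans (proj₂ ends) (cong just (ShiftsTo⇒shift′ 0 (Fin.toℕ-fromℕ< startCycle<n) refl w<n (start-encode w)))
      where ends = start-ends (proj₁ startColumn) (proj₂ startColumn) refl

    endColumn-joins : Joins endColumn (just w) nothing
    endColumn-joins = trans (proj₁ ends) (cong just (ShiftsTo⇒shift′ h (Fin.toℕ-fromℕ< endCycle<n) refl w<n (end-encode w))) , proj₂ ends
      where ends = end-ends (proj₁ endColumn) (proj₂ endColumn) (Fin.toℕ-fromℕ< (ℕ.n<1+n n))

  start-joins⇒column : ∀ {w} (j : Fin n) (i : Fin x) → Joins (j , i) nothing (just w) → toℕ j ≡ evenCycle (+ 2 ℤ.* + w) × toℕ i ≡ 0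
  start-joins⇒column j i (head , tail) with position (Fin.toℕ<n i)
  ... | start i≡0 = sym (start-decode (Fin.toℕ<n j) (end⇒ShiftsTo (toℕ j) 0 refl (proj₂ (start-ends j i i≡0)) tail)) , i≡0
  ... | evenPos _ q<h i≡ = contradiction (trans (sym head) (proj₁ (even-ends j i q<h i≡))) λ ()
  ... | oddPos  _ q<h i≡ = contradiction (trans (sym head) (proj₁ (odd-ends j i q<h i≡))) λ ()
  ... | end i≡n          = contradiction (trans (sym head) (proj₁ (end-ends j i i≡n))) λ ()

  end-joins⇒column : ∀ {w} (j : Fin n) (i : Fin x) → Joins (j , i) (just w) nothing → toℕ j ≡ oddCycle (+ 2 ℤ.* + w) × toℕ i ≡ n
  end-joins⇒column j i (head , tail) with position (Fin.toℕ<n i)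
  ... | end i≡n = sym (end-decode (Fin.toℕ<n j) (end⇒ShiftsTo (toℕ j) h refl (proj₁ (end-ends j i i≡n)) head)) , i≡n
  ... | start i≡0        = contradiction (trans (sym tail) (proj₂ (start-ends j i i≡0))) λ ()
  ... | evenPos _ q<h i≡ = contradiction (trans (sym tail) (proj₂ (even-ends j i q<h i≡))) λ ()
  ... | oddPos  _ q<h i≡ = contradiction (trans (sym tail) (proj₂ (odd-ends j i q<h i≡))) λ ()

  infinity-cover : ∀ {w} → w < n → Cover nothing (just w)
  infinity-cover {w} w<n = record
    { c₁ = startColumn w<n ; c₂ = endColumn w<n ; c₁≢c₂ = c₁≢c₂
    ; covers₁ = inj₁ (startColumn-joins w<n) ; covers₂ = inj₂ (endColumn-joins w<n)
    ; only = only
    ; complementary = subst₂ (λ a b → a ++ b ↭ allFin 6)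
        (sym (trans (proj₂ (forward (startColumn w<n) (startColumn-joins w<n))) (startColumn-entries w<n)))
        (sym (trans (proj₂ (backward (endColumn w<n) (λ ()) (endColumn-joins w<n))) (cong (map neg6) (endColumn-entries w<n))))
        (infinity-complementary (startCycle<n w<n) (cycles-adjacent (+ 2 ℤ.* + w)))
    }
    where
    c₁≢c₂ : startColumn w<n ≢ endColumn w<n
    c₁≢c₂ c₁≡c₂ = contradiction (trans (cong (toℕ ∘ proj₂) c₁≡c₂) (Fin.toℕ-fromℕ< (ℕ.n<1+n n))) λ ()
    only : ∀ c → Covers nothing (just w) c → c ≡ startColumn w<n ⊎ c ≡ endColumn w<n
    only (j , i) (inj₁ joins) = inj₁ (uncurry (column-at-unique (startCycle<n w<n) (s≤s z≤n)) (start-joins⇒column j i joins))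
    only (j , i) (inj₂ joins) = inj₂ (uncurry (column-at-unique (endCycle<n w<n) (ℕ.n<1+n n)) (end-joins⇒column j i joins))

  edge-condition : (u v : Pt) → ValidPt x u → ValidPt x v → u ≢ v →
    (length (incidentCols x u v) ≡ 2) × (concatMap (crossDiffs x T u v) (allCols x) ↭ allFin 6)
  edge-condition nothing  nothing  _   _   u≢v = contradiction refl u≢v
  edge-condition nothing  (just w) _   w<n u≢v = Cover⇒edge-condition u≢v (infinity-cover w<n)
  edge-condition (just w) nothing  w<n _   u≢v = Cover⇒edge-condition u≢v (Cover-sym (λ ()) (infinity-cover w<n))
  edge-condition (just u) (just v) u<n v<n u≢v with evenGap-either u<n v<n (u≢v ∘ cong just)
  ... | inj₁ gap-even = Cover⇒edge-condition u≢v (finite-cover u<n v<n (u≢v ∘ cong just) gap-even)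
  ... | inj₂ gap-even = Cover⇒edge-condition u≢v (Cover-sym (u≢v ∘ sym) (finite-cover v<n u<n (u≢v ∘ cong just ∘ sym) gap-even))


RowSumMatrices : ℕ → Set
RowSumMatrices x = Σ (Matrices x) λ T →
  ((j : Fin (x ∸ 1)) → IsMRSM x T j) ×
  ((j : Fin (x ∸ 1)) → toℕ j < x ∸ 2 → (r : Fin 3) → rowSum x T j r ≡ 3) ×
  ((j : Fin (x ∸ 1)) → toℕ j ≡ x ∸ 2 →
    Σ (Fin 3) λ r →
      (rowSum x T j r ≡ 0 ⊎ rowSum x T j r ≡ 2 ⊎ rowSum x T j r ≡ 4) ×
      ((s : Fin 3) → s ≢ r → rowSum x T j s ≡ 3)) ×
  ((u v : Pt) → ValidPt x u → ValidPt x v → u ≢ v →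
    (length (incidentCols x u v) ≡ 2) ×
    (concatMap (crossDiffs x T u v) (allCols x) ↭ allFin 6))

row-sum-matrices : ∀ m → RowSumMatrices (4 + 4 * m)
row-sum-matrices m = T , is-MRSM , rowSum-ordinary , last-matrix , edge-condition
  where
  open Construction m
  is-MRSM : ∀ j → IsMRSM x T j
  is-MRSM j = Subset.⊤ , (λ _ _ → Subset.∈⊤) , (λ i → columns-distinct (kind (toℕ j)) (toℕ i))
  last-matrix : ∀ j → toℕ j ≡ lastIndex → Σ (Fin 3) λ r →
    (rowSum x T j r ≡ 0 ⊎ rowSum x T j r ≡ 2 ⊎ rowSum x T j r ≡ 4) × (∀ s → s ≢ r → rowSum x T j s ≡ 3)
  last-matrix j j≡ℓ = # 2 , inj₁ (proj₁ (rowSum-last j j≡ℓ)) , proj₂ (rowSum-last j j≡ℓ)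

4or8[mod12]⇒4+4m : ∀ x → x % 12 ≡ 4 ⊎ x % 12 ≡ 8 → Σ ℕ λ m → x ≡ 4 + 4 * m
4or8[mod12]⇒4+4m x (inj₁ x%12≡4) = 3 * (x / 12) , trans (m≡m%n+[m/n]*n x 12) (trans (cong (_+ x / 12 * 12) x%12≡4) (identity (x / 12)))
  where
  identity : ∀ q → 4 + q * 12 ≡ 4 + 4 * (3 * q)
  identity = ℕ-Ring.solve-∀
4or8[mod12]⇒4+4m x (inj₂ x%12≡8) = 1 + 3 * (x / 12) , trans (m≡m%n+[m/n]*n x 12) (trans (cong (_+ x / 12 * 12) x%12≡8) (identity (x / 12)))
  where
  identity : ∀ q → 8 + q * 12 ≡ 4 + 4 * (1 + 3 * q)
  identity = ℕ-Ring.solve-∀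

lemma7 : (x : ℕ) → (x % 12 ≡ 4 ⊎ x % 12 ≡ 8) →
  Σ (Matrices x) λ T →
    ((j : Fin (x ∸ 1)) → IsMRSM x T j) ×
    ((j : Fin (x ∸ 1)) → toℕ j < x ∸ 2 → (r : Fin 3) → rowSum x T j r ≡ 3) ×
    ((j : Fin (x ∸ 1)) → toℕ j ≡ x ∸ 2 →
      Σ (Fin 3) λ r →
        (rowSum x T j r ≡ 0 ⊎ rowSum x T j r ≡ 2 ⊎ rowSum x T j r ≡ 4) ×
        ((s : Fin 3) → s ≢ r → rowSum x T j s ≡ 3)) ×
    ((u v : Pt) → ValidPt x u → ValidPt x v → u ≢ v →
      (length (incidentCols x u v) ≡ 2) ×
      (concatMap (crossDiffs x T u v) (allCols x) ↭ allFin 6))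
lemma7 x x%12 with 4or8[mod12]⇒4+4m x x%12
... | m , refl = row-sum-matrices m
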